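{- Let $\alpha,\beta$ be compositions. Then $$\mathcal{p}_\alpha \mathcal{p}_\beta = \frac{z_\alpha z_\beta}{z_{\alpha\cdot\beta}}\sum_{\gamma\in\alpha\sqcup\!\sqcup\,\beta}\mathcal{p}_\gamma.$$
   Context: A composition $\alpha=\alpha_1\cdots\alpha_{\ell(\alpha)}$ is a finite ordered list of positive integers; $\widetilde\alpha$ is the partition obtained by sorting its parts in weakly decreasing order, and if $\widetilde\alpha=n^{r_n}\cdots 1^{r_1}$ then $z_\alpha=1^{r_1}r_1!\cdots n^{r_n}r_n!$. $\alpha\cdot\beta$ denotes concatenation. The multiset of shuffles $\alpha\sqcup\!\sqcup\,\beta$ consists of all compositions obtained by arranging the parts $\alpha_i$ and $\beta_i$ so that each $\alpha_i$ appears before $\alpha_{i+1}$ and each $\beta_i$ appears before $\beta_{i+1}$ (counted with multiplicity). Combinatorial power sums: Let $\mathbb N_{\mathbb N}=\{a_k: a,k\in\mathbb N\}$ with dual chain order $\mathbb N_{\mathbb N}^*$ given by $1_1>1_2>\cdots>2_1>2_2>\cdots>3_1>\cdots$. For a partition $\lambda=n^{r_n}\cdots1^{r_1}$, let $P^\lambda$ be the poset with no relations on $\{a_k: 1\le k\le r_a\}$, with labelling $\gamma:P^\lambda\to\mathbb N_{\mathbb N}^*$ the inclusion and weight $w(a_k)=a$. For a linear extension (chain) $s$ of $P^\lambda$, given by $u_1<\dots<u_\ell$, set $\alpha(s,w)=(w(u_1),\dots,w(u_\ell))$ and $$K_{(s,\gamma,w)}=\sum_f\prod_{u\in s}x_{f(u)}^{w(u)},$$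 the sum over all maps $f:s\to\mathbb N$ such that for $p<q$ in $s$, $f(p)\le f(q)$, and $f(p)=f(q)$ implies $\gamma(p)<\gamma(q)$ in $\mathbb N_{\mathbb N}^*$. The combinatorial power sum is the quasisymmetric function $\mathcal{p}_\alpha=\sum_{s}K_{(s,\gamma,w)}$, summed over linear extensions $s$ of $P^{\widetilde\alpha}$ with $\alpha(s,w)=\alpha$. -}

module Defs where

open import Data.Nat.Base using (ℕ; zero; suc; _+_; _*_; _∸_; _^_; _!; _≤_; _≤ᵇ_; _<ᵇ_; _≡ᵇ_)
open import Data.Bool.Base using (Bool; true; false; _∧_; _∨_; not; if_then_else_)
open import Data.List.Base using (List; []; _∷_; map; length; upTo; concatMap; _++_; zip)
open import Data.Nat.ListAction using (sum; product)
open import Data.Vec.Base using (Vec; []; _∷_; zipWith; toList)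
open import Data.Product.Base using (_×_; _,_)
open import Data.List.Relation.Unary.All using (All)

IsComposition : List ℕ → Set
IsComposition α = All (λ a → 1 ≤ a) α

mult : ℕ → List ℕ → ℕ
mult a [] = 0
mult a (b ∷ bs) = (if a ≡ᵇ b then 1 else 0) + mult a bs

-- z_α = ∏_a a^{r_a} r_a!  (a ranges over 0..|α|; factors with r_a = 0 are 1)
z : List ℕ → ℕ
z α = product (map (λ a → a ^ mult a α * (mult a α) !) (upTo (suc (sum α))))

-- Multiset of shuffles α ⧢ β, as a list (with multiplicity).
shuffle : List ℕ → List ℕ → List (List ℕ)
shuffle [] ys = ys ∷ []
shuffle (x ∷ xs) [] = (x ∷ xs) ∷ []
shuffle (x ∷ xs) (y ∷ ys) =
  map (x ∷_) (shuffle xs (y ∷ ys)) ++ map (y ∷_) (shuffle (x ∷ xs) ys)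

allB : {A : Set} → (A → Bool) → List A → Bool
allB p [] = true
allB p (x ∷ xs) = p x ∧ allB p xs

allPairsB : {A : Set} → (A → A → Bool) → List A → Bool
allPairsB R [] = true
allPairsB R (x ∷ xs) = allB (R x) xs ∧ allPairsB R xs

eqListB : List ℕ → List ℕ → Bool
eqListB [] [] = true
eqListB (x ∷ xs) (y ∷ ys) = (x ≡ᵇ y) ∧ eqListB xs ys
eqListB _ _ = false

countB : {A : Set} → (A → Bool) → List A → ℕ
countB p [] = 0
countB p (x ∷ xs) = (if p x then 1 else 0) + countB p xs

words : ℕ → List ℕ → List (List ℕ)
words zero xs = [] ∷ []
words (suc ℓ) xs = concatMap (λ x → map (x ∷_) (words ℓ xs)) xs

-- The poset elements a_k are pairs (a , k); weight w(a_k) = a.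
-- Strict order of the dual chain ℕ_ℕ^* : 1_1 > 1_2 > ⋯ > 2_1 > 2_2 > ⋯
-- i.e. a_k < b_j  iff  b < a, or a = b and j < k.

_<*_ : ℕ × ℕ → ℕ × ℕ → Bool
(a , k) <* (b , j) = (b <ᵇ a) ∨ ((a ≡ᵇ b) ∧ (j <ᵇ k))

-- An entry of a chain: the poset element u_i = (a , k) together with
-- the value f(u_i) (variable index, 0-based: v stands for x_{v+1}).
Entry : Set
Entry = (ℕ × ℕ) × ℕ

inPoset : List ℕ → Entry → Bool
inPoset α ((a , k) , v) = (1 ≤ᵇ k) ∧ (k ≤ᵇ mult a α)

distinctElts : Entry → Entry → Bool
distinctElts ((a , k) , _) ((b , j) , _) = not ((a ≡ᵇ b) ∧ (k ≡ᵇ j))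

-- The chain u_1 < ⋯ < u_ℓ (weights α) is a linear extension of P^{α̃}:
-- every u_i lies in P^{α̃} and they are pairwise distinct (the count of
-- weight a equals r_a, so this is a bijection onto P^{α̃}).
isLinExt : List ℕ → List Entry → Bool
isLinExt α t = allB (inPoset α) t ∧ allPairsB distinctElts t

compatible : Entry → Entry → Bool
compatible (u , v) (u' , v') = (v ≤ᵇ v') ∧ (not (v ≡ᵇ v') ∨ (u <* u'))

expo : List Entry → ℕ → ℕ
expo [] x = 0
expo (((a , k) , v) ∷ t) x = (if v ≡ᵇ x then a else 0) + expo t x

-- Formal power series restricted to the variables x_1 … x_n:
-- a series is its coefficient function on exponent vectors.

Series : ℕ → Set
Series n = Vec ℕ n → ℕ

below : {n : ℕ} → Vec ℕ n → List (Vec ℕ n)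
below [] = [] ∷ []
below (x ∷ xs) = concatMap (λ i → map (i ∷_) (below xs)) (upTo (suc x))

_⊛_ : {n : ℕ} → Series n → Series n → Series n
(F ⊛ G) m = sum (map (λ m₁ → F m₁ * G (zipWith _∸_ m m₁)) (below m))

-- Coefficient of x^m (m an exponent vector on x_1 … x_n) in the
-- combinatorial power sum 𝓅_α = Σ_s K_(s,γ,w): the number of pairs (s , f)
-- with s a linear extension of P^{α̃} with α(s,w) = α, f a valid map
-- for K_(s,γ,w), and ∏ x_{f(u)}^{w(u)} = x^m.
-- s is encoded by the list of indices k_i (u_i = (α_i)_{k_i}),
-- f by the list of values v_i = f(u_i).
𝓅 : List ℕ → (n : ℕ) → Series n
𝓅 α n m = countB ok candidates
  where
  ℓ : ℕ
  ℓ = length α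
  candidates : List (List ℕ × List ℕ)
  candidates = concatMap (λ ks → map (ks ,_) (words ℓ (upTo n)))
                         (words ℓ (map suc (upTo ℓ)))
  ok : List ℕ × List ℕ → Bool
  ok (ks , vs) =
    let t = zip (zip α ks) vs in
    isLinExt α t ∧ allPairsB compatible t ∧ eqListB (map (expo t) (upTo n)) (toList m)

module Submission where

-- Consecutive entries either strictly increase in their tag
-- (value first, then decreasing weight) or repeat it, and then their labels decrease.  Cut the
-- chain into maximal runs of equal tag: the labels of the copies of a part a are then fixed by
-- choosing, run by run, which of the still unused labels the run takes, so the coefficient of
-- x^m in 𝓅_α is a sum over the values of products of binomials C(unused copies, run length),
-- the run count R.  With mults! α = ∏ₐ rₐ!, so that z α = (∏ α) · mults! α, the theorem reads
--   mults! (α · β) · (R α ⊛ R β) = mults! α · mults! β · Σ_{γ ∈ α ⧢ β} R γ,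
-- which is proved by induction on |α| + |β|, comparing the tags of the first runs of α and β.
-- If one comes strictly first, it is the first run of the shuffle.  If they coincide, runs of
-- lengths i and j merge into one run of length i + j, reached by C(i + j, i) interleavings of
-- the two blocks, and with M = M₁ + M₂ the identity
--   (M + 1)⋯(M + i + j) C(i + M₁, i) C(j + M₂, j)
--     = (M₁ + 1)⋯(M₁ + i) (M₂ + 1)⋯(M₂ + j) C(i + j, i) C(i + j + M, i + j)
-- balances the factors mults!.

open import Defs
open import Data.Nat.Base using (ℕ; zero; suc; _+_; _*_; _∸_; _^_; _!; _≤_; _<_; _≤ᵇ_; _<ᵇ_; _≡ᵇ_; z≤n; s≤s; s≤s⁻¹; z<s; s<s)
open import Data.Nat.Properties
open import Data.Nat.ListAction using (sum; product)
open import Data.Nat.ListAction.Properties using (sum-++; product-++)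
open import Data.Nat.Tactic.RingSolver using (solve-∀)
open import Data.Bool.Base using (Bool; true; false; _∧_; _∨_; not; if_then_else_)
open import Data.Bool.Properties using (∧-assoc; ∧-zeroʳ; ∧-identityʳ; ∨-zeroʳ; if-eta; if-cong; if-cong-then; T-≡)
open import Data.List.Base using (List; []; _∷_; map; length; upTo; concatMap; _++_; zip; applyUpTo; replicate; zipWith)
open import Data.List.Properties using (map-cong; map-++; map-∘; ++-assoc; ++-identityʳ; length-++; length-replicate)
open import Data.List.Relation.Unary.All as All using (All; []; _∷_)
import Data.List.Relation.Unary.All.Properties as AllP
open import Data.List.Relation.Unary.AllPairs using (AllPairs; []; _∷_)
import Data.List.Relation.Unary.AllPairs.Properties as AllPairsP
open import Data.List.Relation.Binary.Permutation.Propositional using (_↭_; ↭-sym; ↭-trans; prep; swap)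
  renaming (refl to ↭-refl; trans to ↭-step)
import Data.List.Relation.Binary.Permutation.Propositional.Properties as Perm
import Data.Vec.Base as Vec
open import Data.Vec.Base using (Vec; []; _∷_; toList)
open import Data.Product.Base using (_×_; _,_; proj₁; proj₂)
open import Data.Sum.Base using (_⊎_; inj₁; inj₂)
open import Data.Empty using (⊥-elim)
open import Relation.Binary.Definitions using (tri<; tri≈; tri>)
open import Relation.Nullary using (¬_)
open import Relation.Binary.PropositionalEquality
open import Function.Base using (id)
open import Function.Bundles using (Equivalence)
import Algebra.Properties.CommutativeSemigroup as CommSemigroupProperties

+-interchange : ∀ a b c d → a + b + (c + d) ≡ a + c + (b + d)
+-interchange = CommSemigroupProperties.interchange +-commutativeSemigroup

*-interchange : ∀ a b c d → a * b * (c * d) ≡ a * c * (b * d)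
*-interchange = CommSemigroupProperties.interchange *-commutativeSemigroup

-- Finite sums

module _ {A : Set} where
  sum-map-cong : (f g : A → ℕ) (xs : List A) → (∀ x → f x ≡ g x) → sum (map f xs) ≡ sum (map g xs)
  sum-map-cong f g xs h = cong sum (map-cong h xs)

  sum-map-congAll : (f g : A → ℕ) (xs : List A) → All (λ x → f x ≡ g x) xs → sum (map f xs) ≡ sum (map g xs)
  sum-map-congAll f g [] [] = refl
  sum-map-congAll f g (x ∷ xs) (h ∷ hs) = cong₂ _+_ h (sum-map-congAll f g xs hs)

  sum-map-zero : (f : A → ℕ) (xs : List A) → (∀ x → f x ≡ 0) → sum (map f xs) ≡ 0
  sum-map-zero f [] h = refl
  sum-map-zero f (x ∷ xs) h = cong₂ _+_ (h x) (sum-map-zero f xs h)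

  sum-map-+ : (f g : A → ℕ) (xs : List A) → sum (map (λ x → f x + g x) xs) ≡ sum (map f xs) + sum (map g xs)
  sum-map-+ f g [] = refl
  sum-map-+ f g (x ∷ xs) = trans (cong (f x + g x +_) (sum-map-+ f g xs)) (+-interchange (f x) (g x) _ _)

  sum-map-* : (k : ℕ) (f : A → ℕ) (xs : List A) → sum (map (λ x → k * f x) xs) ≡ k * sum (map f xs)
  sum-map-* k f [] = sym (*-zeroʳ k)
  sum-map-* k f (x ∷ xs) = trans (cong (k * f x +_) (sum-map-* k f xs)) (sym (*-distribˡ-+ k (f x) _))

  sum-map-*ʳ : (k : ℕ) (f : A → ℕ) (xs : List A) → sum (map (λ x → f x * k) xs) ≡ sum (map f xs) * k
  sum-map-*ʳ k f xs = trans (sum-map-cong _ _ xs (λ x → *-comm (f x) k)) (trans (sum-map-* k f xs) (*-comm k _))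

  sum-map-++ : (f : A → ℕ) (xs ys : List A) → sum (map f (xs ++ ys)) ≡ sum (map f xs) + sum (map f ys)
  sum-map-++ f xs ys = trans (cong sum (map-++ f xs ys)) (sum-++ (map f xs) (map f ys))

  sum-map-if : (c : Bool) (f : A → ℕ) (xs : List A) → sum (map (λ x → if c then f x else 0) xs) ≡ (if c then sum (map f xs) else 0)
  sum-map-if true f xs = refl
  sum-map-if false f xs = sum-map-zero _ xs (λ _ → refl)

  sum-map-*-if : ∀ k (c : A → Bool) (f : A → ℕ) xs →
    k * sum (map (λ x → if c x then f x else 0) xs) ≡ sum (map (λ x → if c x then k * f x else 0) xs)
  sum-map-*-if k c f xs = trans (sym (sum-map-* k _ xs)) (sum-map-cong _ _ xs (λ x → *-if (c x) (f x)))
    where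
    *-if : ∀ b y → k * (if b then y else 0) ≡ (if b then k * y else 0)
    *-if true y = refl
    *-if false y = *-zeroʳ k

module _ {A B : Set} where
  sum-map-map : (f : B → ℕ) (g : A → B) (xs : List A) → sum (map f (map g xs)) ≡ sum (map (λ x → f (g x)) xs)
  sum-map-map f g xs = cong sum (sym (map-∘ xs))

  sum-concatMap : (f : B → ℕ) (g : A → List B) (xs : List A) → sum (map f (concatMap g xs)) ≡ sum (map (λ x → sum (map f (g x))) xs)
  sum-concatMap f g [] = refl
  sum-concatMap f g (x ∷ xs) = trans (sum-map-++ f (g x) (concatMap g xs)) (cong (sum (map f (g x)) +_) (sum-concatMap f g xs))

  sum-swap : (f : A → B → ℕ) (xs : List A) (ys : List B) →
    sum (map (λ x → sum (map (λ y → f x y) ys)) xs) ≡ sum (map (λ y → sum (map (λ x → f x y) xs)) ys)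
  sum-swap f [] ys = sym (sum-map-zero _ ys (λ _ → refl))
  sum-swap f (x ∷ xs) ys = trans (cong (sum (map (λ y → f x y) ys) +_) (sum-swap f xs ys))
                                 (sym (sum-map-+ (λ y → f x y) (λ y → sum (map (λ x' → f x' y) xs)) ys))

countB-sum : {A : Set} (p : A → Bool) (xs : List A) → countB p xs ≡ sum (map (λ x → if p x then 1 else 0) xs)
countB-sum p [] = refl
countB-sum p (x ∷ xs) = cong ((if p x then 1 else 0) +_) (countB-sum p xs)

sumTo : ℕ → (ℕ → ℕ) → ℕ
sumTo zero g = 0
sumTo (suc N) g = g 0 + sumTo N (λ j → g (suc j))

sumTo-cong : ∀ N (f g : ℕ → ℕ) → (∀ j → j < N → f j ≡ g j) → sumTo N f ≡ sumTo N g
sumTo-cong zero f g h = refl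
sumTo-cong (suc N) f g h = cong₂ _+_ (h 0 (s≤s z≤n)) (sumTo-cong N _ _ (λ j p → h (suc j) (s≤s p)))

sumTo-zero : ∀ N (f : ℕ → ℕ) → (∀ j → f j ≡ 0) → sumTo N f ≡ 0
sumTo-zero zero f h = refl
sumTo-zero (suc N) f h = cong₂ _+_ (h 0) (sumTo-zero N _ (λ j → h (suc j)))

sumTo-+ : ∀ N (f g : ℕ → ℕ) → sumTo N (λ j → f j + g j) ≡ sumTo N f + sumTo N g
sumTo-+ zero f g = refl
sumTo-+ (suc N) f g =
  trans (cong (f 0 + g 0 +_) (sumTo-+ N (λ j → f (suc j)) (λ j → g (suc j)))) (+-interchange (f 0) (g 0) _ _)

sumTo-*ʳ : ∀ N k (f : ℕ → ℕ) → sumTo N (λ j → f j * k) ≡ sumTo N f * k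
sumTo-*ʳ zero k f = refl
sumTo-*ʳ (suc N) k f = trans (cong (f 0 * k +_) (sumTo-*ʳ N k (λ j → f (suc j)))) (sym (*-distribʳ-+ k (f 0) _))

sumTo-if : ∀ N (c : Bool) (f : ℕ → ℕ) → sumTo N (λ j → if c then f j else 0) ≡ (if c then sumTo N f else 0)
sumTo-if N true f = refl
sumTo-if N false f = sumTo-zero N _ (λ _ → refl)

sumTo-snoc : ∀ N (f : ℕ → ℕ) → sumTo (suc N) f ≡ sumTo N f + f N
sumTo-snoc zero f = +-comm (f 0) 0
sumTo-snoc (suc N) f = trans (cong (f 0 +_) (sumTo-snoc N (λ j → f (suc j)))) (sym (+-assoc (f 0) _ _))

sum-applyUpTo : ∀ N (f : ℕ → ℕ) (g : ℕ → ℕ) → sum (map f (applyUpTo g N)) ≡ sumTo N (λ j → f (g j))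
sum-applyUpTo zero f g = refl
sum-applyUpTo (suc N) f g = cong (f (g 0) +_) (sum-applyUpTo N f (λ j → g (suc j)))

sum-upTo : ∀ N (f : ℕ → ℕ) → sum (map f (upTo N)) ≡ sumTo N f
sum-upTo N f = sum-applyUpTo N f id

sum-upTo-cong : ∀ N (f g : ℕ → ℕ) → (∀ v → v < N → f v ≡ g v) → sum (map f (upTo N)) ≡ sum (map g (upTo N))
sum-upTo-cong N f g h = trans (sum-upTo N f) (trans (sumTo-cong N f g h) (sym (sum-upTo N g)))

-- Binomial coefficients

-- Pascal's recursion, rather than Data.Nat.Combinatorics._C_ (defined by division), so that it computes.
choose : ℕ → ℕ → ℕ
choose n zero = 1
choose zero (suc k) = 0
choose (suc n) (suc k) = choose n k + choose n (suc k)

choose-0 : ∀ n → choose n 0 ≡ 1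
choose-0 zero = refl
choose-0 (suc n) = refl

choose-> : ∀ n k → n < k → choose n k ≡ 0
choose-> zero (suc k) p = refl
choose-> (suc n) (suc k) (s≤s p) = cong₂ _+_ (choose-> n k p) (choose-> n (suc k) (≤-trans p (n≤1+n k)))

choose-diag : ∀ n → choose n n ≡ 1
choose-diag zero = refl
choose-diag (suc n) = cong₂ _+_ (choose-diag n) (choose-> n (suc n) ≤-refl)

choose-1 : ∀ n → choose n 1 ≡ n
choose-1 zero = refl
choose-1 (suc n) = cong suc (choose-1 n)

hockey-stick : ∀ N s → sumTo N (λ j → choose j s) ≡ choose N (suc s)
hockey-stick zero s = refl
hockey-stick (suc N) s = trans (sumTo-snoc N (λ j → choose j s))
  (trans (cong (_+ choose N s) (hockey-stick N s)) (+-comm (choose N (suc s)) (choose N s)))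

choose-absorption : ∀ n k → suc k * choose (suc n) (suc k) ≡ suc n * choose n k
choose-absorption zero zero = refl
choose-absorption zero (suc k) = *-zeroʳ (suc (suc k))
choose-absorption (suc n) zero = trans (+-identityʳ _) (trans (choose-1 (suc (suc n))) (sym (*-identityʳ (suc (suc n)))))
choose-absorption (suc n) (suc k) = begin
    suc (suc k) * (A + B)
      ≡⟨ *-distribˡ-+ (suc (suc k)) A B ⟩
    suc (suc k) * A + suc (suc k) * B
      ≡⟨ cong (suc (suc k) * A +_) (choose-absorption n (suc k)) ⟩
    A + suc k * A + suc n * choose n (suc k)
      ≡⟨ cong (λ x → A + x + suc n * choose n (suc k)) (choose-absorption n k) ⟩
    A + suc n * choose n k + suc n * choose n (suc k)
      ≡⟨ +-assoc A _ _ ⟩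
    A + (suc n * choose n k + suc n * choose n (suc k))
      ≡⟨ cong (A +_) (sym (*-distribˡ-+ (suc n) (choose n k) (choose n (suc k)))) ⟩
    A + suc n * A ∎
  where
  open ≡-Reasoning
  A = choose (suc n) (suc k)
  B = choose (suc n) (suc (suc k))

choose-factorials : ∀ i M → choose (i + M) i * (i ! * M !) ≡ (i + M) !
choose-factorials zero M = trans (cong (λ x → x * (1 * M !)) (choose-0 M)) (trans (*-identityˡ _) (*-identityˡ _))
choose-factorials (suc i) M = begin
    C * (suc i * i ! * M !)
      ≡⟨ cong (C *_) (*-assoc (suc i) (i !) (M !)) ⟩
    C * (suc i * (i ! * M !))
      ≡⟨ sym (*-assoc C (suc i) _) ⟩
    C * suc i * (i ! * M !)
      ≡⟨ cong (_* (i ! * M !)) (trans (*-comm C (suc i)) (choose-absorption (i + M) i)) ⟩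
    suc (i + M) * choose (i + M) i * (i ! * M !)
      ≡⟨ *-assoc (suc (i + M)) (choose (i + M) i) (i ! * M !) ⟩
    suc (i + M) * (choose (i + M) i * (i ! * M !))
      ≡⟨ cong (suc (i + M) *_) (choose-factorials i M) ⟩
    suc (i + M) * (i + M) ! ∎
  where
  open ≡-Reasoning
  C = choose (suc (i + M)) (suc i)

rising : ℕ → ℕ → ℕ
rising M zero = 1
rising M (suc i) = suc (i + M) * rising M i

rising≡choose*! : ∀ M i → rising M i ≡ choose (i + M) i * i !
rising≡choose*! M i = *-cancelʳ-≡ (rising M i) (choose (i + M) i * i !) (M !) {{M !≢0}}
  (trans (rising-* M i) (trans (sym (choose-factorials i M)) (sym (*-assoc (choose (i + M) i) (i !) (M !)))))
  where
  rising-* : ∀ M i → rising M i * M ! ≡ (i + M) !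
  rising-* M zero = *-identityˡ _
  rising-* M (suc i) = trans (*-assoc (suc (i + M)) (rising M i) (M !)) (cong (suc (i + M) *_) (rising-* M i))

rising-choose-identity : ∀ i j M₁ M₂ →
  rising (M₁ + M₂) (i + j) * (choose (i + M₁) i * choose (j + M₂) j)
    ≡ rising M₁ i * rising M₂ j * (choose (i + j) i * choose (i + j + (M₁ + M₂)) (i + j))
rising-choose-identity i j M₁ M₂ = begin
    rising (M₁ + M₂) (i + j) * (c₁ * c₂)
      ≡⟨ cong (_* (c₁ * c₂)) (rising≡choose*! (M₁ + M₂) (i + j)) ⟩
    cN * (i + j) ! * (c₁ * c₂)
      ≡⟨ cong (λ x → cN * x * (c₁ * c₂)) (sym (choose-factorials i j)) ⟩
    cN * (cij * (i ! * j !)) * (c₁ * c₂)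
      ≡⟨ rearrange cN cij (i !) (j !) c₁ c₂ ⟩
    c₁ * i ! * (c₂ * j !) * (cij * cN)
      ≡⟨ cong₂ (λ x y → x * y * (cij * cN)) (sym (rising≡choose*! M₁ i)) (sym (rising≡choose*! M₂ j)) ⟩
    rising M₁ i * rising M₂ j * (cij * cN) ∎
  where
  open ≡-Reasoning
  c₁ = choose (i + M₁) i
  c₂ = choose (j + M₂) j
  cij = choose (i + j) i
  cN = choose (i + j + (M₁ + M₂)) (i + j)
  rearrange : ∀ a b c d e f → a * (b * (c * d)) * (e * f) ≡ e * c * (f * d) * (b * a)
  rearrange = solve-∀

-- Multiplicities and permutations

≡ᵇ-refl : ∀ a → (a ≡ᵇ a) ≡ true
≡ᵇ-refl a = Equivalence.to T-≡ (≡⇒≡ᵇ a a refl)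

≡ᵇ-true⇒≡ : ∀ a b → (a ≡ᵇ b) ≡ true → a ≡ b
≡ᵇ-true⇒≡ a b e = ≡ᵇ⇒≡ a b (Equivalence.from T-≡ e)

≡ᵇ-false⇒≢ : ∀ a b → (a ≡ᵇ b) ≡ false → a ≢ b
≡ᵇ-false⇒≢ a .a e refl with () ← trans (sym e) (≡ᵇ-refl a)

≢⇒≡ᵇ-false : ∀ {a b} → a ≢ b → (a ≡ᵇ b) ≡ false
≢⇒≡ᵇ-false {a} {b} a≢b with a ≡ᵇ b in e
... | true = ⊥-elim (a≢b (≡ᵇ-true⇒≡ a b e))
... | false = refl

≡ᵇ-sym : ∀ a b → (a ≡ᵇ b) ≡ (b ≡ᵇ a)
≡ᵇ-sym zero zero = refl
≡ᵇ-sym zero (suc b) = refl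
≡ᵇ-sym (suc a) zero = refl
≡ᵇ-sym (suc a) (suc b) = ≡ᵇ-sym a b

<ᵇ-true⇒< : ∀ m n → (m <ᵇ n) ≡ true → m < n
<ᵇ-true⇒< m n e = <ᵇ⇒< m n (Equivalence.from T-≡ e)

<⇒<ᵇ-true : ∀ {m n} → m < n → (m <ᵇ n) ≡ true
<⇒<ᵇ-true m<n = Equivalence.to T-≡ (<⇒<ᵇ m<n)

≤⇒<ᵇ-false : ∀ {m n} → n ≤ m → (m <ᵇ n) ≡ false
≤⇒<ᵇ-false {m} {zero} _ = refl
≤⇒<ᵇ-false {suc m} {suc n} (s≤s p) = ≤⇒<ᵇ-false p

≤ᵇ-true⇒≤ : ∀ m n → (m ≤ᵇ n) ≡ true → m ≤ n
≤ᵇ-true⇒≤ m n e = ≤ᵇ⇒≤ m n (Equivalence.from T-≡ e)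

≤⇒≤ᵇ-true : ∀ {m n} → m ≤ n → (m ≤ᵇ n) ≡ true
≤⇒≤ᵇ-true m≤n = Equivalence.to T-≡ (≤⇒≤ᵇ m≤n)

∧-true⇒× : ∀ x y → (x ∧ y) ≡ true → x ≡ true × y ≡ true
∧-true⇒× true y e = refl , e

∨-true⇒⊎ : ∀ x y → (x ∨ y) ≡ true → x ≡ true ⊎ y ≡ true
∨-true⇒⊎ true y e = inj₁ refl
∨-true⇒⊎ false y e = inj₂ e

mult-++ : ∀ a xs ys → mult a (xs ++ ys) ≡ mult a xs + mult a ys
mult-++ a [] ys = refl
mult-++ a (x ∷ xs) ys =
  trans (cong ((if a ≡ᵇ x then 1 else 0) +_) (mult-++ a xs ys)) (sym (+-assoc (if a ≡ᵇ x then 1 else 0) (mult a xs) (mult a ys)))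

mult-∷-self : ∀ a xs → mult a (a ∷ xs) ≡ suc (mult a xs)
mult-∷-self a xs rewrite ≡ᵇ-refl a = refl

mult-replicate : ∀ a i xs → mult a (replicate i a ++ xs) ≡ i + mult a xs
mult-replicate a zero xs = refl
mult-replicate a (suc i) xs = trans (mult-∷-self a (replicate i a ++ xs)) (cong suc (mult-replicate a i xs))

mult-↭ : ∀ a {xs ys} → xs ↭ ys → mult a xs ≡ mult a ys
mult-↭ a ↭-refl = refl
mult-↭ a (prep x p) = cong ((if a ≡ᵇ x then 1 else 0) +_) (mult-↭ a p)
mult-↭ a (swap x y p) = trans (sym (+-assoc (if a ≡ᵇ x then 1 else 0) (if a ≡ᵇ y then 1 else 0) _))
   (trans (cong₂ _+_ (+-comm (if a ≡ᵇ x then 1 else 0) (if a ≡ᵇ y then 1 else 0)) (mult-↭ a p))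
          (+-assoc (if a ≡ᵇ y then 1 else 0) (if a ≡ᵇ x then 1 else 0) _))
mult-↭ a (↭-step p q) = trans (mult-↭ a p) (mult-↭ a q)

mult≤length : ∀ a α → mult a α ≤ length α
mult≤length a [] = z≤n
mult≤length a (x ∷ xs) with a ≡ᵇ x
... | true = s≤s (mult≤length a xs)
... | false = ≤-trans (mult≤length a xs) (n≤1+n _)

mult-pos⇒< : ∀ a α B → All (_< B) α → 1 ≤ mult a α → a < B
mult-pos⇒< a (x ∷ xs) B (h ∷ hs) p with a ≡ᵇ x in e
... | true with refl ← ≡ᵇ-true⇒≡ a x e = h
... | false = mult-pos⇒< a xs B hs p

-- mults! α = ∏ₐ (mult a α)!
mults! : List ℕ → ℕ
mults! [] = 1
mults! (x ∷ xs) = suc (mult x xs) * mults! xs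

mults!-replicate : ∀ a i xs → mults! (replicate i a ++ xs) ≡ rising (mult a xs) i * mults! xs
mults!-replicate a zero xs = sym (*-identityˡ (mults! xs))
mults!-replicate a (suc i) xs = begin
    suc (mult a (replicate i a ++ xs)) * mults! (replicate i a ++ xs)
      ≡⟨ cong₂ (λ u w → suc u * w) (mult-replicate a i xs) (mults!-replicate a i xs) ⟩
    suc (i + mult a xs) * (rising (mult a xs) i * mults! xs)
      ≡⟨ sym (*-assoc (suc (i + mult a xs)) (rising (mult a xs) i) (mults! xs)) ⟩
    rising (mult a xs) (suc i) * mults! xs ∎
  where open ≡-Reasoning

mults!-↭ : ∀ {xs ys} → xs ↭ ys → mults! xs ≡ mults! ys
mults!-↭ ↭-refl = refl
mults!-↭ (prep x p) = cong₂ (λ u w → suc u * w) (mult-↭ x p) (mults!-↭ p)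
mults!-↭ {x ∷ y ∷ xs} {.y ∷ .x ∷ ys} (swap x y p) with x ≡ᵇ y in e
... | true with refl ← ≡ᵇ-true⇒≡ x y e rewrite ≡ᵇ-refl x | mult-↭ x p | mults!-↭ p = refl
... | false rewrite trans (≡ᵇ-sym y x) e | mult-↭ x p | mult-↭ y p | mults!-↭ p =
  exchange (mult x ys) (mult y ys) (mults! ys)
  where
  exchange : ∀ a b c → suc a * (suc b * c) ≡ suc b * (suc a * c)
  exchange = solve-∀
mults!-↭ (↭-step p q) = trans (mults!-↭ p) (mults!-↭ q)

++-replicate : ∀ (a : ℕ) i j X → replicate i a ++ (replicate j a ++ X) ≡ replicate (i + j) a ++ X
++-replicate a zero j X = refl
++-replicate a (suc i) j X = cong (a ∷_) (++-replicate a i j X)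

length-replicate-++ : ∀ (a : ℕ) i (x : List ℕ) → length (replicate i a ++ x) ≡ i + length x
length-replicate-++ a i x = trans (length-++ (replicate i a)) (cong (_+ length x) (length-replicate i))

mults!-merge-runs : ∀ a i j α β → mults! ((replicate i a ++ α) ++ (replicate j a ++ β))
                               ≡ rising (mult a α + mult a β) (i + j) * mults! (α ++ β)
mults!-merge-runs a i j α β = begin
    mults! ((replicate i a ++ α) ++ (replicate j a ++ β))
      ≡⟨ cong mults! (++-assoc (replicate i a) α (replicate j a ++ β)) ⟩
    mults! (replicate i a ++ (α ++ (replicate j a ++ β)))
      ≡⟨ mults!-↭ (Perm.++⁺ˡ (replicate i a) (Perm.shifts α (replicate j a))) ⟩
    mults! (replicate i a ++ (replicate j a ++ (α ++ β)))
      ≡⟨ cong mults! (++-replicate a i j (α ++ β)) ⟩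
    mults! (replicate (i + j) a ++ (α ++ β))
      ≡⟨ mults!-replicate a (i + j) (α ++ β) ⟩
    rising (mult a (α ++ β)) (i + j) * mults! (α ++ β)
      ≡⟨ cong (λ x → rising x (i + j) * mults! (α ++ β)) (mult-++ a α β) ⟩
    rising (mult a α + mult a β) (i + j) * mults! (α ++ β) ∎
  where open ≡-Reasoning

shuffle-↭ : ∀ α β → All (_↭ α ++ β) (shuffle α β)
shuffle-↭ [] β = ↭-refl ∷ []
shuffle-↭ (x ∷ xs) [] = ↭-sym (Perm.++-identityʳ (x ∷ xs)) ∷ []
shuffle-↭ (x ∷ xs) (y ∷ ys) = AllP.++⁺
  (AllP.map⁺ (All.map (prep x) (shuffle-↭ xs (y ∷ ys))))
  (AllP.map⁺ (All.map (λ p → ↭-trans (prep y p) (↭-sym (Perm.shift y (x ∷ xs) ys))) (shuffle-↭ (x ∷ xs) ys)))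

shuffle-[]ʳ : ∀ α → shuffle α [] ≡ α ∷ []
shuffle-[]ʳ [] = refl
shuffle-[]ʳ (x ∷ xs) = refl

-- Series and convolution

𝟙 : Bool → ℕ
𝟙 b = if b then 1 else 0

𝟙-∧ : ∀ p q → 𝟙 (p ∧ q) ≡ 𝟙 p * 𝟙 q
𝟙-∧ true q = sym (+-identityʳ (𝟙 q))
𝟙-∧ false q = refl

δ : {k : ℕ} → List ℕ → Series k
δ xs m = 𝟙 (eqListB xs (toList m))

module _ {k : ℕ} where
  ⊛-congˡ : (F F' G : Series k) (m : Vec ℕ k) → (∀ x → F x ≡ F' x) → (F ⊛ G) m ≡ (F' ⊛ G) m
  ⊛-congˡ F F' G m h = sum-map-cong _ _ (below m) (λ m₁ → cong (_* G (Vec.zipWith _∸_ m m₁)) (h m₁))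

  ⊛-congʳ : (F G G' : Series k) (m : Vec ℕ k) → (∀ x → G x ≡ G' x) → (F ⊛ G) m ≡ (F ⊛ G') m
  ⊛-congʳ F G G' m h = sum-map-cong _ _ (below m) (λ m₁ → cong (F m₁ *_) (h (Vec.zipWith _∸_ m m₁)))

  ⊛-sumˡ : {A : Set} (f : A → Series k) (vs : List A) (G : Series k) (m : Vec ℕ k) →
    ((λ x → sum (map (λ v → f v x) vs)) ⊛ G) m ≡ sum (map (λ v → (f v ⊛ G) m) vs)
  ⊛-sumˡ f vs G m = trans (sum-map-cong _ _ (below m) (λ m₁ → sym (sum-map-*ʳ (G (Vec.zipWith _∸_ m m₁)) (λ v → f v m₁) vs)))
                          (sum-swap (λ m₁ v → f v m₁ * G (Vec.zipWith _∸_ m m₁)) (below m) vs)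

  ⊛-sumʳ : {A : Set} (F : Series k) (f : A → Series k) (vs : List A) (m : Vec ℕ k) →
    (F ⊛ (λ x → sum (map (λ v → f v x) vs))) m ≡ sum (map (λ v → (F ⊛ f v) m) vs)
  ⊛-sumʳ F f vs m = trans (sum-map-cong _ _ (below m) (λ m₁ → sym (sum-map-* (F m₁) (λ v → f v (Vec.zipWith _∸_ m m₁)) vs)))
                          (sum-swap (λ m₁ v → F m₁ * f v (Vec.zipWith _∸_ m m₁)) (below m) vs)

  ⊛-+ˡ : (F F' G : Series k) (m : Vec ℕ k) → ((λ x → F x + F' x) ⊛ G) m ≡ (F ⊛ G) m + (F' ⊛ G) m
  ⊛-+ˡ F F' G m = trans (sum-map-cong _ _ (below m) (λ m₁ → *-distribʳ-+ (G (Vec.zipWith _∸_ m m₁)) (F m₁) (F' m₁)))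
                        (sum-map-+ _ _ (below m))

  ⊛-+ʳ : (F G G' : Series k) (m : Vec ℕ k) → (F ⊛ (λ x → G x + G' x)) m ≡ (F ⊛ G) m + (F ⊛ G') m
  ⊛-+ʳ F G G' m = trans (sum-map-cong _ _ (below m) (λ m₁ → *-distribˡ-+ (F m₁) (G (Vec.zipWith _∸_ m m₁)) (G' (Vec.zipWith _∸_ m m₁))))
                        (sum-map-+ _ _ (below m))

  ⊛-*ˡ : (c : ℕ) (F G : Series k) (m : Vec ℕ k) → ((λ x → c * F x) ⊛ G) m ≡ c * (F ⊛ G) m
  ⊛-*ˡ c F G m = trans (sum-map-cong _ _ (below m) (λ m₁ → *-assoc c (F m₁) (G (Vec.zipWith _∸_ m m₁))))
                       (sum-map-* c _ (below m))

  ⊛-*ʳ : (c : ℕ) (F G : Series k) (m : Vec ℕ k) → (F ⊛ (λ x → c * G x)) m ≡ c * (F ⊛ G) m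
  ⊛-*ʳ c F G m = trans (sum-map-cong _ _ (below m) (λ m₁ → x*[c*y]≡c*[x*y] (F m₁) (G (Vec.zipWith _∸_ m m₁))))
                       (sum-map-* c _ (below m))
    where
    x*[c*y]≡c*[x*y] : ∀ x y → x * (c * y) ≡ c * (x * y)
    x*[c*y]≡c*[x*y] x y = trans (sym (*-assoc x c y)) (trans (cong (_* y) (*-comm x c)) (*-assoc c x y))

  ⊛-zeroˡ : (G : Series k) (m : Vec ℕ k) → ((λ _ → 0) ⊛ G) m ≡ 0
  ⊛-zeroˡ G m = sum-map-zero _ (below m) (λ _ → refl)

  ⊛-zeroʳ : (F : Series k) (m : Vec ℕ k) → (F ⊛ (λ _ → 0)) m ≡ 0
  ⊛-zeroʳ F m = sum-map-zero _ (below m) (λ m₁ → *-zeroʳ (F m₁))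

  ⊛-ifˡ : (c : Bool) (F G : Series k) (m : Vec ℕ k) → ((λ x → if c then F x else 0) ⊛ G) m ≡ (if c then (F ⊛ G) m else 0)
  ⊛-ifˡ true F G m = refl
  ⊛-ifˡ false F G m = ⊛-zeroˡ G m

  ⊛-ifʳ : (c : Bool) (F G : Series k) (m : Vec ℕ k) → (F ⊛ (λ x → if c then G x else 0)) m ≡ (if c then (F ⊛ G) m else 0)
  ⊛-ifʳ true F G m = refl
  ⊛-ifʳ false F G m = ⊛-zeroʳ F m

sum-δ-antidiagonal : ∀ x y c → sum (map (λ i → 𝟙 (x ≡ᵇ i) * 𝟙 (y ≡ᵇ (c ∸ i))) (upTo (suc c))) ≡ 𝟙 ((x + y) ≡ᵇ c)
sum-δ-antidiagonal x y c = trans (sum-upTo (suc c) _) (go x y c)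
  where
  go : ∀ x y c → sumTo (suc c) (λ i → 𝟙 (x ≡ᵇ i) * 𝟙 (y ≡ᵇ (c ∸ i))) ≡ 𝟙 ((x + y) ≡ᵇ c)
  go zero y c = trans (cong₂ _+_ (+-identityʳ (𝟙 (y ≡ᵇ c))) (sumTo-zero c _ (λ _ → refl))) (+-identityʳ _)
  go (suc x) y zero = refl
  go (suc x) y (suc c) = go x y c

δ-⊛ : ∀ {k} (m : Vec ℕ k) (xs ys : List ℕ) → length xs ≡ length ys →
  (δ xs ⊛ δ ys) m ≡ δ (zipWith _+_ xs ys) m
δ-⊛ [] [] [] e = refl
δ-⊛ [] (x ∷ xs) (y ∷ ys) e = refl
δ-⊛ (c ∷ m) [] [] e = trans (sum-concatMap _ (λ i → map (i ∷_) (below m)) (upTo (suc c)))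
  (sum-map-zero _ (upTo (suc c)) (λ i → trans (sum-map-map _ (i ∷_) (below m)) (sum-map-zero _ (below m) (λ _ → refl))))
δ-⊛ (c ∷ m) (x ∷ xs) (y ∷ ys) e = begin
    sum (map f (concatMap (λ i → map (i ∷_) (below m)) (upTo (suc c))))
      ≡⟨ sum-concatMap f (λ i → map (i ∷_) (below m)) (upTo (suc c)) ⟩
    sum (map (λ i → sum (map f (map (i ∷_) (below m)))) (upTo (suc c)))
      ≡⟨ sum-map-cong _ _ (upTo (suc c)) (λ i → trans (sum-map-map f (i ∷_) (below m)) (head-factor i)) ⟩
    sum (map (λ i → 𝟙 (x ≡ᵇ i) * 𝟙 (y ≡ᵇ (c ∸ i)) * δ (zipWith _+_ xs ys) m) (upTo (suc c)))
      ≡⟨ sum-map-*ʳ (δ (zipWith _+_ xs ys) m) (λ i → 𝟙 (x ≡ᵇ i) * 𝟙 (y ≡ᵇ (c ∸ i))) (upTo (suc c)) ⟩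
    sum (map (λ i → 𝟙 (x ≡ᵇ i) * 𝟙 (y ≡ᵇ (c ∸ i))) (upTo (suc c))) * δ (zipWith _+_ xs ys) m
      ≡⟨ cong (_* δ (zipWith _+_ xs ys) m) (sum-δ-antidiagonal x y c) ⟩
    𝟙 ((x + y) ≡ᵇ c) * δ (zipWith _+_ xs ys) m
      ≡⟨ sym (𝟙-∧ ((x + y) ≡ᵇ c) _) ⟩
    δ (zipWith _+_ (x ∷ xs) (y ∷ ys)) (c ∷ m) ∎
  where
  open ≡-Reasoning
  f : Vec ℕ _ → ℕ
  f m₁ = δ (x ∷ xs) m₁ * δ (y ∷ ys) (Vec.zipWith _∸_ (c ∷ m) m₁)
  head-factor : ∀ i → sum (map (λ m₁ → δ (x ∷ xs) (i ∷ m₁) * δ (y ∷ ys) ((c ∸ i) ∷ Vec.zipWith _∸_ m m₁)) (below m))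
                      ≡ 𝟙 (x ≡ᵇ i) * 𝟙 (y ≡ᵇ (c ∸ i)) * δ (zipWith _+_ xs ys) m
  head-factor i = begin
      sum (map (λ m₁ → δ (x ∷ xs) (i ∷ m₁) * δ (y ∷ ys) ((c ∸ i) ∷ Vec.zipWith _∸_ m m₁)) (below m))
        ≡⟨ sum-map-cong _ _ (below m) (λ m₁ → trans (cong₂ _*_ (𝟙-∧ (x ≡ᵇ i) _) (𝟙-∧ (y ≡ᵇ (c ∸ i)) _))
                                                  (*-interchange (𝟙 (x ≡ᵇ i)) _ (𝟙 (y ≡ᵇ (c ∸ i))) _)) ⟩
      sum (map (λ m₁ → 𝟙 (x ≡ᵇ i) * 𝟙 (y ≡ᵇ (c ∸ i)) * (δ xs m₁ * δ ys (Vec.zipWith _∸_ m m₁))) (below m))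
        ≡⟨ sum-map-* (𝟙 (x ≡ᵇ i) * 𝟙 (y ≡ᵇ (c ∸ i))) (λ m₁ → δ xs m₁ * δ ys (Vec.zipWith _∸_ m m₁)) (below m) ⟩
      𝟙 (x ≡ᵇ i) * 𝟙 (y ≡ᵇ (c ∸ i)) * (δ xs ⊛ δ ys) m
        ≡⟨ cong (𝟙 (x ≡ᵇ i) * 𝟙 (y ≡ᵇ (c ∸ i)) *_) (δ-⊛ m xs ys (suc-injective e)) ⟩
      𝟙 (x ≡ᵇ i) * 𝟙 (y ≡ᵇ (c ∸ i)) * δ (zipWith _+_ xs ys) m ∎

-- Run counts

Offset : Set
Offset = ℕ → ℕ

_⊕_ : Offset → Offset → Offset
(o₁ ⊕ o₂) x = o₁ x + o₂ x

bump : Offset → ℕ → ℕ → Offset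
bump o v a x = o x + (if v ≡ᵇ x then a else 0)

-- An entry of weight a with value v may follow one of weight a₀ with value v₀ without
-- continuing its run: the value increases, or it stays and the weight decreases.
after : ℕ → ℕ → ℕ → ℕ → Bool
after v a v₀ a₀ = (v₀ <ᵇ v) ∨ ((v₀ ≡ᵇ v) ∧ (a <ᵇ a₀))

bump-⊕ˡ : (o₁ o : Offset) (v a : ℕ) → ∀ x → (o₁ ⊕ bump o v a) x ≡ bump (o₁ ⊕ o) v a x
bump-⊕ˡ o₁ o v a x = sym (+-assoc (o₁ x) (o x) _)

bump-⊕ʳ : (o o₂ : Offset) (v a : ℕ) → ∀ x → (bump o v a ⊕ o₂) x ≡ bump (o ⊕ o₂) v a x
bump-⊕ʳ o o₂ v a x = trans (+-assoc (o x) _ (o₂ x)) (trans (cong (o x +_) (+-comm _ (o₂ x))) (sym (+-assoc (o x) (o₂ x) _)))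

bumpN : ℕ → ℕ → ℕ → Offset → Offset
bumpN v a zero o = o
bumpN v a (suc i) o = bumpN v a i (bump o v a)

bumpN-closed : ∀ v a i (o : Offset) x → bumpN v a i o x ≡ o x + i * (if v ≡ᵇ x then a else 0)
bumpN-closed v a zero o x = sym (+-identityʳ (o x))
bumpN-closed v a (suc i) o x = trans (bumpN-closed v a i (bump o v a) x) (+-assoc (o x) (if v ≡ᵇ x then a else 0) _)

bumpN-⊕ : ∀ v a i j (o₁ o₂ : Offset) x → (bumpN v a i o₁ ⊕ bumpN v a j o₂) x ≡ bumpN v a (i + j) (o₁ ⊕ o₂) x
bumpN-⊕ v a i j o₁ o₂ x
  rewrite bumpN-closed v a i o₁ x | bumpN-closed v a j o₂ x | bumpN-closed v a (i + j) (o₁ ⊕ o₂) x =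
  regroup (o₁ x) (o₂ x) i j (if v ≡ᵇ x then a else 0)
  where
  regroup : ∀ p q i j d → p + i * d + (q + j * d) ≡ p + q + (i + j) * d
  regroup = solve-∀

-- R α v₀ a₀ o m counts the ways to continue a chain whose last entry has weight a₀ and value
-- v₀ by the weights α, with exponent o so far, to reach x^m.  Run α v a N s o m is the same
-- count when the chain ends in a run of s entries of weight a and value v, begun when N copies
-- of a were still unlabelled: the run takes a decreasing s-subset of those labels.
module RunCount (n : ℕ) where
  vars : List ℕ
  vars = upTo n

  x^ : Offset → Series n
  x^ o = δ (map o vars)

  mutual
    R : List ℕ → ℕ → ℕ → Offset → Series n
    R [] v₀ a₀ o m = x^ o m
    R (a ∷ α) v₀ a₀ o m = sum (map (λ v → if after v a v₀ a₀ then Run α v a (suc (mult a α)) 1 (bump o v a) m else 0) vars)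

    Run : List ℕ → ℕ → ℕ → ℕ → ℕ → Offset → Series n
    Run α v a N s o m = choose N s * R α v a o m + Run⁺ α v a N s o m

    Run⁺ : List ℕ → ℕ → ℕ → ℕ → ℕ → Offset → Series n
    Run⁺ [] v a N s o m = 0
    Run⁺ (b ∷ β) v a N s o m = if b ≡ᵇ a then Run β v a N (suc s) (bump o v a) m else 0

  mutual
    R-cong : ∀ α v₀ a₀ (o o' : Offset) m → (∀ x → o x ≡ o' x) → R α v₀ a₀ o m ≡ R α v₀ a₀ o' m
    R-cong [] v₀ a₀ o o' m h = cong (λ l → δ l m) (map-cong h vars)
    R-cong (a ∷ α) v₀ a₀ o o' m h = sum-map-cong _ _ vars (λ v → if-cong-then (after v a v₀ a₀)
      (Run-cong α v a (suc (mult a α)) 1 (bump o v a) (bump o' v a) m (λ x → cong (_+ (if v ≡ᵇ x then a else 0)) (h x))))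

    Run-cong : ∀ α v a N s (o o' : Offset) m → (∀ x → o x ≡ o' x) → Run α v a N s o m ≡ Run α v a N s o' m
    Run-cong α v a N s o o' m h = cong₂ _+_ (cong (choose N s *_) (R-cong α v a o o' m h)) (Run⁺-cong α v a N s o o' m h)

    Run⁺-cong : ∀ α v a N s (o o' : Offset) m → (∀ x → o x ≡ o' x) → Run⁺ α v a N s o m ≡ Run⁺ α v a N s o' m
    Run⁺-cong [] v a N s o o' m h = refl
    Run⁺-cong (b ∷ β) v a N s o o' m h = if-cong-then (b ≡ᵇ a)
      (Run-cong β v a N (suc s) (bump o v a) (bump o' v a) m (λ x → cong (_+ (if v ≡ᵇ x then a else 0)) (h x)))

  x^-⊛-x^ : (o₁ o₂ : Offset) (m : Vec ℕ n) → (x^ o₁ ⊛ x^ o₂) m ≡ x^ (o₁ ⊕ o₂) m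
  x^-⊛-x^ o₁ o₂ m = trans (δ-⊛ m (map o₁ vars) (map o₂ vars) (length-map₂ vars)) (cong (λ l → δ l m) (zipWith-map vars))
    where
    zipWith-map : (xs : List ℕ) → zipWith _+_ (map o₁ xs) (map o₂ xs) ≡ map (o₁ ⊕ o₂) xs
    zipWith-map [] = refl
    zipWith-map (x ∷ xs) = cong (_ ∷_) (zipWith-map xs)
    length-map₂ : (xs : List ℕ) → length (map o₁ xs) ≡ length (map o₂ xs)
    length-map₂ [] = refl
    length-map₂ (x ∷ xs) = cong suc (length-map₂ xs)

  mutual
    x^-⊛-R : ∀ β v₀ a₀ (o₁ o₂ : Offset) m → (x^ o₁ ⊛ R β v₀ a₀ o₂) m ≡ R β v₀ a₀ (o₁ ⊕ o₂) m
    x^-⊛-R [] v₀ a₀ o₁ o₂ m = x^-⊛-x^ o₁ o₂ m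
    x^-⊛-R (b ∷ β) v₀ a₀ o₁ o₂ m =
      trans (⊛-sumʳ (x^ o₁) (λ v x → if after v b v₀ a₀ then Run β v b (suc (mult b β)) 1 (bump o₂ v b) x else 0) vars m)
      (sum-map-cong _ _ vars (λ v → trans (⊛-ifʳ (after v b v₀ a₀) (x^ o₁) (Run β v b (suc (mult b β)) 1 (bump o₂ v b)) m)
        (if-cong-then (after v b v₀ a₀) (trans (x^-⊛-Run β v b (suc (mult b β)) 1 o₁ (bump o₂ v b) m)
          (Run-cong β v b (suc (mult b β)) 1 _ _ m (bump-⊕ˡ o₁ o₂ v b))))))

    x^-⊛-Run : ∀ β v a N s (o₁ o₂ : Offset) m → (x^ o₁ ⊛ Run β v a N s o₂) m ≡ Run β v a N s (o₁ ⊕ o₂) m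
    x^-⊛-Run β v a N s o₁ o₂ m =
      trans (⊛-+ʳ (x^ o₁) (λ x → choose N s * R β v a o₂ x) (Run⁺ β v a N s o₂) m)
        (cong₂ _+_ (trans (⊛-*ʳ (choose N s) (x^ o₁) (R β v a o₂) m) (cong (choose N s *_) (x^-⊛-R β v a o₁ o₂ m)))
                   (x^-⊛-Run⁺ β v a N s o₁ o₂ m))

    x^-⊛-Run⁺ : ∀ β v a N s (o₁ o₂ : Offset) m → (x^ o₁ ⊛ Run⁺ β v a N s o₂) m ≡ Run⁺ β v a N s (o₁ ⊕ o₂) m
    x^-⊛-Run⁺ [] v a N s o₁ o₂ m = ⊛-zeroʳ (x^ o₁) m
    x^-⊛-Run⁺ (b ∷ β) v a N s o₁ o₂ m =
      trans (⊛-ifʳ (b ≡ᵇ a) (x^ o₁) (Run β v a N (suc s) (bump o₂ v a)) m)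
        (if-cong-then (b ≡ᵇ a) (trans (x^-⊛-Run β v a N (suc s) o₁ (bump o₂ v a) m)
          (Run-cong β v a N (suc s) _ _ m (bump-⊕ˡ o₁ o₂ v a))))

  mutual
    R-⊛-x^ : ∀ β v₀ a₀ (o₁ o₂ : Offset) m → (R β v₀ a₀ o₁ ⊛ x^ o₂) m ≡ R β v₀ a₀ (o₁ ⊕ o₂) m
    R-⊛-x^ [] v₀ a₀ o₁ o₂ m = x^-⊛-x^ o₁ o₂ m
    R-⊛-x^ (b ∷ β) v₀ a₀ o₁ o₂ m =
      trans (⊛-sumˡ (λ v x → if after v b v₀ a₀ then Run β v b (suc (mult b β)) 1 (bump o₁ v b) x else 0) vars (x^ o₂) m)
      (sum-map-cong _ _ vars (λ v → trans (⊛-ifˡ (after v b v₀ a₀) (Run β v b (suc (mult b β)) 1 (bump o₁ v b)) (x^ o₂) m)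
        (if-cong-then (after v b v₀ a₀) (trans (Run-⊛-x^ β v b (suc (mult b β)) 1 (bump o₁ v b) o₂ m)
          (Run-cong β v b (suc (mult b β)) 1 _ _ m (bump-⊕ʳ o₁ o₂ v b))))))

    Run-⊛-x^ : ∀ β v a N s (o₁ o₂ : Offset) m → (Run β v a N s o₁ ⊛ x^ o₂) m ≡ Run β v a N s (o₁ ⊕ o₂) m
    Run-⊛-x^ β v a N s o₁ o₂ m =
      trans (⊛-+ˡ (λ x → choose N s * R β v a o₁ x) (Run⁺ β v a N s o₁) (x^ o₂) m)
        (cong₂ _+_ (trans (⊛-*ˡ (choose N s) (R β v a o₁) (x^ o₂) m) (cong (choose N s *_) (R-⊛-x^ β v a o₁ o₂ m)))
                   (Run⁺-⊛-x^ β v a N s o₁ o₂ m))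

    Run⁺-⊛-x^ : ∀ β v a N s (o₁ o₂ : Offset) m → (Run⁺ β v a N s o₁ ⊛ x^ o₂) m ≡ Run⁺ β v a N s (o₁ ⊕ o₂) m
    Run⁺-⊛-x^ [] v a N s o₁ o₂ m = ⊛-zeroˡ (x^ o₂) m
    Run⁺-⊛-x^ (b ∷ β) v a N s o₁ o₂ m =
      trans (⊛-ifˡ (b ≡ᵇ a) (Run β v a N (suc s) (bump o₁ v a)) (x^ o₂) m)
        (if-cong-then (b ≡ᵇ a) (trans (Run-⊛-x^ β v a N (suc s) (bump o₁ v a) o₂ m)
          (Run-cong β v a N (suc s) _ _ m (bump-⊕ʳ o₁ o₂ v a))))

-- Shuffles

-- Σprefix ℓ H α sums H i x over all ways of writing α = ℓ ^ i ++ x.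
Σprefix : ℕ → (ℕ → List ℕ → ℕ) → List ℕ → ℕ
Σprefix ℓ H [] = H 0 []
Σprefix ℓ H (x ∷ xs) = H 0 (x ∷ xs) + (if x ≡ᵇ ℓ then Σprefix ℓ (λ i → H (suc i)) xs else 0)

Σprefix-cong-local : ∀ ℓ (H H' : ℕ → List ℕ → ℕ) α →
  (∀ i x → α ≡ replicate i ℓ ++ x → H i x ≡ H' i x) → Σprefix ℓ H α ≡ Σprefix ℓ H' α
Σprefix-cong-local ℓ H H' [] h = h 0 [] refl
Σprefix-cong-local ℓ H H' (x ∷ xs) h with x ≡ᵇ ℓ in e
... | true = cong₂ _+_ (h 0 (x ∷ xs) refl)
      (Σprefix-cong-local ℓ (λ i → H (suc i)) (λ i → H' (suc i)) xs
        (λ i y p → h (suc i) y (cong₂ _∷_ (≡ᵇ-true⇒≡ x ℓ e) p)))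
... | false = cong (_+ 0) (h 0 (x ∷ xs) refl)

Σprefix-cong : ∀ ℓ (H H' : ℕ → List ℕ → ℕ) α → (∀ i x → H i x ≡ H' i x) → Σprefix ℓ H α ≡ Σprefix ℓ H' α
Σprefix-cong ℓ H H' α h = Σprefix-cong-local ℓ H H' α (λ i x _ → h i x)

Σprefix-+ : ∀ ℓ (H H' : ℕ → List ℕ → ℕ) α → Σprefix ℓ (λ i x → H i x + H' i x) α ≡ Σprefix ℓ H α + Σprefix ℓ H' α
Σprefix-+ ℓ H H' [] = refl
Σprefix-+ ℓ H H' (x ∷ xs) with x ≡ᵇ ℓ
... | true = trans (cong (H 0 (x ∷ xs) + H' 0 (x ∷ xs) +_) (Σprefix-+ ℓ (λ i → H (suc i)) (λ i → H' (suc i)) xs))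
                   (+-interchange (H 0 (x ∷ xs)) (H' 0 (x ∷ xs)) _ _)
... | false = trans (+-identityʳ _) (sym (cong₂ _+_ (+-identityʳ (H 0 (x ∷ xs))) (+-identityʳ (H' 0 (x ∷ xs)))))

Σprefix-* : ∀ ℓ k (H : ℕ → List ℕ → ℕ) α → Σprefix ℓ (λ i x → k * H i x) α ≡ k * Σprefix ℓ H α
Σprefix-* ℓ k H [] = refl
Σprefix-* ℓ k H (x ∷ xs) with x ≡ᵇ ℓ
... | true = trans (cong (k * H 0 (x ∷ xs) +_) (Σprefix-* ℓ k (λ i → H (suc i)) xs)) (sym (*-distribˡ-+ k (H 0 (x ∷ xs)) _))
... | false = trans (+-identityʳ _) (cong (k *_) (sym (+-identityʳ _)))

Σprefix-zero : ∀ ℓ α → Σprefix ℓ (λ _ _ → 0) α ≡ 0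
Σprefix-zero ℓ [] = refl
Σprefix-zero ℓ (x ∷ xs) with x ≡ᵇ ℓ
... | true = Σprefix-zero ℓ xs
... | false = refl

Σprefix-if : ∀ ℓ (c : Bool) (H : ℕ → List ℕ → ℕ) α → Σprefix ℓ (λ i x → if c then H i x else 0) α ≡ (if c then Σprefix ℓ H α else 0)
Σprefix-if ℓ true H α = refl
Σprefix-if ℓ false H α = Σprefix-zero ℓ α

if-+ : ∀ (c : Bool) a b → (if c then a + b else 0) ≡ (if c then a else 0) + (if c then b else 0)
if-+ true a b = refl
if-+ false a b = refl

-- Σprefix² ℓ G α β: strip leading blocks ℓ ^ i from α and ℓ ^ j from β; their C(i + j, i)
-- interleavings form the leading block of a shuffle.
Σprefix² : ℕ → (ℕ → List ℕ → ℕ) → List ℕ → List ℕ → ℕ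
Σprefix² ℓ G α β = Σprefix ℓ (λ i α' → Σprefix ℓ (λ j β' → choose (i + j) i * sum (map (G (i + j)) (shuffle α' β'))) β) α

Σprefix²-pascal : ∀ ℓ (G : ℕ → List ℕ → ℕ) xs y ys →
  Σprefix ℓ (λ i α' → Σprefix ℓ (λ j β' → choose (suc i + j) (suc i) * sum (map (G (suc i + j)) (shuffle α' β'))) (y ∷ ys)) xs
    ≡ Σprefix² ℓ (λ s → G (suc s)) xs (y ∷ ys)
      + (if y ≡ᵇ ℓ then Σprefix ℓ (λ i α' → Σprefix ℓ (λ j β' →
              choose (suc i + j) (suc i) * sum (map (G (suc (suc i + j))) (shuffle α' β'))) ys) xs else 0)
Σprefix²-pascal ℓ G xs y ys =
  trans (Σprefix-cong ℓ _ _ xs split) (trans (Σprefix-+ ℓ _ _ xs) (cong (Σprefix² ℓ G↑ xs (y ∷ ys) +_) (Σprefix-if ℓ (y ≡ᵇ ℓ) _ xs)))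
  where
  G↑ : ℕ → List ℕ → ℕ
  G↑ s = G (suc s)
  split : ∀ i α' → choose (suc i + 0) (suc i) * sum (map (G (suc i + 0)) (shuffle α' (y ∷ ys)))
                    + (if y ≡ᵇ ℓ then Σprefix ℓ (λ j β' → choose (suc i + suc j) (suc i) * sum (map (G (suc i + suc j)) (shuffle α' β'))) ys else 0)
                  ≡ choose (i + 0) i * sum (map (G↑ (i + 0)) (shuffle α' (y ∷ ys)))
                    + (if y ≡ᵇ ℓ then Σprefix ℓ (λ j β' → choose (i + suc j) i * sum (map (G↑ (i + suc j)) (shuffle α' β'))) ys else 0)
                    + (if y ≡ᵇ ℓ then Σprefix ℓ (λ j β' → choose (suc i + j) (suc i) * sum (map (G (suc (suc i + j))) (shuffle α' β'))) ys else 0)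
  split i α' = trans (cong₂ _+_
       (cong (_* sum (map (G (suc i + 0)) (shuffle α' (y ∷ ys))))
         (trans (cong (choose (i + 0) i +_) (choose-> (i + 0) (suc i) (s≤s (≤-reflexive (+-identityʳ i))))) (+-identityʳ _)))
       (if-cong-then (y ≡ᵇ ℓ) (trans (Σprefix-cong ℓ _ _ ys (λ j β' → *-distribʳ-+ _ (choose (i + suc j) i) (choose (i + suc j) (suc i))))
          (trans (Σprefix-+ ℓ _ _ ys) (cong (Σprefix ℓ (λ j β' → choose (i + suc j) i * sum (map (G↑ (i + suc j)) (shuffle α' β'))) ys +_)
            (Σprefix-cong ℓ _ _ ys (λ j β' → cong₂ (λ u w → choose u (suc i) * sum (map (G w) (shuffle α' β'))) (+-suc i j) (cong suc (+-suc i j)))))))))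
      (trans (cong (_ +_) (if-+ (y ≡ᵇ ℓ) _ _)) (sym (+-assoc _ (if y ≡ᵇ ℓ then _ else 0) (if y ≡ᵇ ℓ then _ else 0))))

sum-shuffle-Σprefix : ∀ ℓ (G : ℕ → List ℕ → ℕ) α β → sum (map (Σprefix ℓ G) (shuffle α β)) ≡ Σprefix² ℓ G α β
sum-shuffle-Σprefix ℓ G [] β = trans (+-identityʳ _) (Σprefix-cong ℓ _ _ β (λ j β' → sym (trans (+-identityʳ _) (+-identityʳ _))))
sum-shuffle-Σprefix ℓ G (x ∷ xs) [] = trans (+-identityʳ _)
  (Σprefix-cong ℓ _ _ (x ∷ xs) (λ i α' → sym (trans (cong₂ (λ u w → choose u i * sum (map (G u) w)) (+-identityʳ i) (shuffle-[]ʳ α'))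
     (trans (cong (_* (G i α' + 0)) (choose-diag i)) (trans (+-identityʳ _) (+-identityʳ _))))))
sum-shuffle-Σprefix ℓ G (x ∷ xs) (y ∷ ys) = begin
    sum (map (Σprefix ℓ G) (map (x ∷_) S₁ ++ map (y ∷_) S₂))
      ≡⟨ sum-map-++ (Σprefix ℓ G) (map (x ∷_) S₁) (map (y ∷_) S₂) ⟩
    sum (map (Σprefix ℓ G) (map (x ∷_) S₁)) + sum (map (Σprefix ℓ G) (map (y ∷_) S₂))
      ≡⟨ cong₂ _+_ (trans (sum-map-map (Σprefix ℓ G) (x ∷_) S₁) (sum-map-+ (λ γ → G 0 (x ∷ γ)) (λ γ → if x ≡ᵇ ℓ then Σprefix ℓ G↑ γ else 0) S₁))
                   (trans (sum-map-map (Σprefix ℓ G) (y ∷_) S₂) (sum-map-+ (λ γ → G 0 (y ∷ γ)) (λ γ → if y ≡ᵇ ℓ then Σprefix ℓ G↑ γ else 0) S₂)) ⟩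
    (P₁ + sum (map (λ γ → if x ≡ᵇ ℓ then Σprefix ℓ G↑ γ else 0) S₁)) + (P₂ + sum (map (λ γ → if y ≡ᵇ ℓ then Σprefix ℓ G↑ γ else 0) S₂))
      ≡⟨ cong₂ (λ u w → (P₁ + u) + (P₂ + w))
           (trans (sum-map-if (x ≡ᵇ ℓ) (Σprefix ℓ G↑) S₁) (if-cong-then (x ≡ᵇ ℓ) (sum-shuffle-Σprefix ℓ G↑ xs (y ∷ ys))))
           (trans (sum-map-if (y ≡ᵇ ℓ) (Σprefix ℓ G↑) S₂) (if-cong-then (y ≡ᵇ ℓ) (sum-shuffle-Σprefix ℓ G↑ (x ∷ xs) ys))) ⟩
    (P₁ + (if x ≡ᵇ ℓ then Σprefix² ℓ G↑ xs (y ∷ ys) else 0)) + (P₂ + (if y ≡ᵇ ℓ then A + (if x ≡ᵇ ℓ then X else 0) else 0))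
      ≡⟨ regroup (x ≡ᵇ ℓ) (y ≡ᵇ ℓ) P₁ P₂ (Σprefix² ℓ G↑ xs (y ∷ ys)) A X ⟩
    ((P₁ + P₂) + (if y ≡ᵇ ℓ then A else 0)) + (if x ≡ᵇ ℓ then Σprefix² ℓ G↑ xs (y ∷ ys) + (if y ≡ᵇ ℓ then X else 0) else 0)
      ≡⟨ cong₂ (λ u w → (u + (if y ≡ᵇ ℓ then A else 0)) + (if x ≡ᵇ ℓ then w else 0))
           (trans (cong₂ _+_ (sym (sum-map-map (G 0) (x ∷_) S₁)) (sym (sum-map-map (G 0) (y ∷_) S₂)))
                  (trans (sym (sum-map-++ (G 0) (map (x ∷_) S₁) (map (y ∷_) S₂))) (sym (+-identityʳ _))))
           (sym (Σprefix²-pascal ℓ G xs y ys)) ⟩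
    Σprefix² ℓ G (x ∷ xs) (y ∷ ys) ∎
  where
  open ≡-Reasoning
  G↑ : ℕ → List ℕ → ℕ
  G↑ s = G (suc s)
  S₁ = shuffle xs (y ∷ ys)
  S₂ = shuffle (x ∷ xs) ys
  P₁ = sum (map (λ γ → G 0 (x ∷ γ)) S₁)
  P₂ = sum (map (λ γ → G 0 (y ∷ γ)) S₂)
  A = Σprefix ℓ (λ j β' → 1 * sum (map (G (suc j)) (shuffle (x ∷ xs) β'))) ys
  X = Σprefix ℓ (λ i α' → Σprefix ℓ (λ j β' → choose (suc i + j) (suc i) * sum (map (G (suc (suc i + j))) (shuffle α' β'))) ys) xs
  regroup : ∀ (bx by : Bool) p₁ p₂ d a x₃ →
    (p₁ + (if bx then d else 0)) + (p₂ + (if by then a + (if bx then x₃ else 0) else 0))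
      ≡ ((p₁ + p₂) + (if by then a else 0)) + (if bx then d + (if by then x₃ else 0) else 0)
  regroup true true p₁ p₂ d a x₃ = ring p₁ p₂ d a x₃
    where
    ring : ∀ p₁ p₂ d a x₃ → p₁ + d + (p₂ + (a + x₃)) ≡ p₁ + p₂ + a + (d + x₃)
    ring = solve-∀
  regroup true false p₁ p₂ d a x₃ = ring p₁ p₂ d
    where
    ring : ∀ p₁ p₂ d → p₁ + d + (p₂ + 0) ≡ p₁ + p₂ + 0 + (d + 0)
    ring = solve-∀
  regroup false true p₁ p₂ d a x₃ = ring p₁ p₂ a
    where
    ring : ∀ p₁ p₂ a → p₁ + 0 + (p₂ + (a + 0)) ≡ p₁ + p₂ + a + 0
    ring = solve-∀
  regroup false false p₁ p₂ d a x₃ = ring p₁ p₂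
    where
    ring : ∀ p₁ p₂ → p₁ + 0 + (p₂ + 0) ≡ p₁ + p₂ + 0 + 0
    ring = solve-∀

-- The tag order

After : ℕ → ℕ → ℕ → ℕ → Set
After v a v₀ a₀ = v₀ < v ⊎ (v₀ ≡ v × a < a₀)

after-sound : ∀ v a v₀ a₀ → after v a v₀ a₀ ≡ true → After v a v₀ a₀
after-sound v a v₀ a₀ e with ∨-true⇒⊎ (v₀ <ᵇ v) _ e
... | inj₁ p = inj₁ (<ᵇ-true⇒< v₀ v p)
... | inj₂ q with ∧-true⇒× (v₀ ≡ᵇ v) _ q
...   | p , r = inj₂ (≡ᵇ-true⇒≡ v₀ v p , <ᵇ-true⇒< a a₀ r)

after-complete : ∀ v a v₀ a₀ → After v a v₀ a₀ → after v a v₀ a₀ ≡ true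
after-complete v a v₀ a₀ (inj₁ p) rewrite <⇒<ᵇ-true p = refl
after-complete v a v₀ a₀ (inj₂ (refl , p)) rewrite <⇒<ᵇ-true p | ≡ᵇ-refl v₀ | ≤⇒<ᵇ-false (≤-refl {v₀}) = refl

after-false : ∀ v a v₀ a₀ → ¬ After v a v₀ a₀ → after v a v₀ a₀ ≡ false
after-false v a v₀ a₀ ¬p with after v a v₀ a₀ in e
... | true = ⊥-elim (¬p (after-sound v a v₀ a₀ e))
... | false = refl

After-trans : ∀ {w c v a v₀ a₀} → After w c v a → After v a v₀ a₀ → After w c v₀ a₀
After-trans (inj₁ p) (inj₁ q) = inj₁ (<-trans q p)
After-trans (inj₁ p) (inj₂ (refl , q)) = inj₁ p
After-trans (inj₂ (refl , p)) (inj₁ q) = inj₁ q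
After-trans (inj₂ (refl , p)) (inj₂ (refl , q)) = inj₂ (refl , <-trans p q)

after-trans : ∀ w c v a v₀ a₀ → after w c v a ≡ true → after v a v₀ a₀ ≡ true → after w c v₀ a₀ ≡ true
after-trans w c v a v₀ a₀ p q = after-complete w c v₀ a₀ (After-trans (after-sound w c v a p) (after-sound v a v₀ a₀ q))

after-self : ∀ v a → after v a v a ≡ false
after-self v a rewrite ≤⇒<ᵇ-false (≤-refl {v}) | ≤⇒<ᵇ-false (≤-refl {a}) | ≡ᵇ-refl v = refl

data TagOrder (v a w c : ℕ) : Set where
  later  : after w c v a ≡ true → after v a w c ≡ false → ((v ≡ᵇ w) ∧ (a ≡ᵇ c)) ≡ false → TagOrder v a w c
  sooner : after w c v a ≡ false → after v a w c ≡ true → ((v ≡ᵇ w) ∧ (a ≡ᵇ c)) ≡ false → TagOrder v a w c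
  same   : v ≡ w → a ≡ c → TagOrder v a w c

compare-tags : ∀ v a w c → TagOrder v a w c
compare-tags v a w c with <-cmp v w
... | tri< p ¬q _ = later (after-complete w c v a (inj₁ p)) (after-false v a w c (λ { (inj₁ r) → <-asym p r ; (inj₂ (r , _)) → ¬q (sym r) }))
                          (cong (_∧ (a ≡ᵇ c)) (≢⇒≡ᵇ-false ¬q))
... | tri> _ ¬q p = sooner (after-false w c v a (λ { (inj₁ r) → <-asym p r ; (inj₂ (r , _)) → ¬q r })) (after-complete v a w c (inj₁ p))
                           (cong (_∧ (a ≡ᵇ c)) (≢⇒≡ᵇ-false ¬q))
... | tri≈ _ refl _ with <-cmp a c
...   | tri< p ¬q _ = sooner (after-false v c v a (λ { (inj₁ r) → <-irrefl refl r ; (inj₂ (_ , r)) → <-asym p r }))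
                             (after-complete v a v c (inj₂ (refl , p)))
                             (trans (cong ((v ≡ᵇ v) ∧_) (≢⇒≡ᵇ-false ¬q)) (∧-zeroʳ (v ≡ᵇ v)))
...   | tri> _ ¬q p = later (after-complete v c v a (inj₂ (refl , p)))
                            (after-false v a v c (λ { (inj₁ r) → <-irrefl refl r ; (inj₂ (_ , r)) → <-asym p r }))
                            (trans (cong ((v ≡ᵇ v) ∧_) (≢⇒≡ᵇ-false ¬q)) (∧-zeroʳ (v ≡ᵇ v)))
...   | tri≈ _ refl _ = same refl refl

-- Of two entries that both come after (v₀ , a₀), one comes after the other or they share their tag.
after-both : ∀ v a w c v₀ a₀ q →
  (if after v a v₀ a₀ then (if after w c v₀ a₀ then q else 0) else 0)
   ≡ (if after v a v₀ a₀ then (if after w c v a then q else 0) else 0)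
     + (if after w c v₀ a₀ then (if after v a w c then q else 0) else 0)
     + (if after v a v₀ a₀ then (if (v ≡ᵇ w) ∧ (a ≡ᵇ c) then q else 0) else 0)
after-both v a w c v₀ a₀ q with compare-tags v a w c
... | later e₁ e₂ e₃ rewrite e₁ | e₂ | e₃ with after v a v₀ a₀ in e
...   | true rewrite after-trans w c v a v₀ a₀ e₁ e = sym (trans (+-identityʳ _) (+-identityʳ q))
...   | false = sym (cong (_+ 0) (if-eta (after w c v₀ a₀)))
after-both v a w c v₀ a₀ q | sooner e₁ e₂ e₃ rewrite e₁ | e₂ | e₃ with after w c v₀ a₀ in e
...   | true rewrite after-trans v a w c v₀ a₀ e₂ e = sym (+-identityʳ q)
...   | false = trans (if-eta (after v a v₀ a₀)) (sym (cong₂ (λ x y → x + 0 + y) (if-eta (after v a v₀ a₀)) (if-eta (after v a v₀ a₀))))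
after-both v a .v .a v₀ a₀ q | same refl refl rewrite after-self v a | ≡ᵇ-refl v | ≡ᵇ-refl a with after v a v₀ a₀
... | true = refl
... | false = refl

sum-upTo-≡ᵇ : ∀ N v (b : Bool) (h : ℕ → ℕ) → v < N →
  sum (map (λ w → if (v ≡ᵇ w) ∧ b then h w else 0) (upTo N)) ≡ (if b then h v else 0)
sum-upTo-≡ᵇ N v b h p = trans (sum-upTo N _) (go N v h p)
  where
  go : ∀ N v (h : ℕ → ℕ) → v < N → sumTo N (λ w → if (v ≡ᵇ w) ∧ b then h w else 0) ≡ (if b then h v else 0)
  go (suc N) zero h p = trans (cong ((if b then h 0 else 0) +_) (sumTo-zero N _ (λ _ → refl))) (+-identityʳ _)
  go (suc N) (suc v) h (s≤s p) = go N v (λ w → h (suc w)) p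

-- The product formula for run counts

module ProductFormula (n : ℕ) where
  open RunCount n

  Run≡Σprefix : ∀ α v a N s (o : Offset) m → Run α v a N s o m ≡ Σprefix a (λ i x → choose N (s + i) * R x v a (bumpN v a i o) m) α
  Run≡Σprefix [] v a N s o m = trans (+-identityʳ _) (cong (λ z → choose N z * x^ o m) (sym (+-identityʳ s)))
  Run≡Σprefix (b ∷ β) v a N s o m = cong₂ _+_ (cong (λ z → choose N z * R (b ∷ β) v a o m) (sym (+-identityʳ s)))
    (if-cong-then (b ≡ᵇ a) (trans (Run≡Σprefix β v a N (suc s) (bump o v a) m)
       (Σprefix-cong a _ _ β (λ i x → cong (λ z → choose N z * R x v a (bumpN v a i (bump o v a)) m) (sym (+-suc s i))))))

  Σprefix-⊛ˡ : ∀ ℓ (H : ℕ → List ℕ → Series n) α (G : Series n) m →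
    ((λ y → Σprefix ℓ (λ i x → H i x y) α) ⊛ G) m ≡ Σprefix ℓ (λ i x → (H i x ⊛ G) m) α
  Σprefix-⊛ˡ ℓ H [] G m = refl
  Σprefix-⊛ˡ ℓ H (x ∷ xs) G m =
    trans (⊛-+ˡ (H 0 (x ∷ xs)) (λ y → if x ≡ᵇ ℓ then Σprefix ℓ (λ i z → H (suc i) z y) xs else 0) G m)
      (cong ((H 0 (x ∷ xs) ⊛ G) m +_) (trans (⊛-ifˡ (x ≡ᵇ ℓ) (λ y → Σprefix ℓ (λ i z → H (suc i) z y) xs) G m)
         (if-cong-then (x ≡ᵇ ℓ) (Σprefix-⊛ˡ ℓ (λ i → H (suc i)) xs G m))))

  Σprefix-⊛ʳ : ∀ ℓ (F : Series n) (H : ℕ → List ℕ → Series n) α m →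
    (F ⊛ (λ y → Σprefix ℓ (λ i x → H i x y) α)) m ≡ Σprefix ℓ (λ i x → (F ⊛ H i x) m) α
  Σprefix-⊛ʳ ℓ F H [] m = refl
  Σprefix-⊛ʳ ℓ F H (x ∷ xs) m =
    trans (⊛-+ʳ F (H 0 (x ∷ xs)) (λ y → if x ≡ᵇ ℓ then Σprefix ℓ (λ i z → H (suc i) z y) xs else 0) m)
      (cong ((F ⊛ H 0 (x ∷ xs)) m +_) (trans (⊛-ifʳ (x ≡ᵇ ℓ) F (λ y → Σprefix ℓ (λ i z → H (suc i) z y) xs) m)
         (if-cong-then (x ≡ᵇ ℓ) (Σprefix-⊛ʳ ℓ F (λ i → H (suc i)) xs m))))

  Run-⊛ʳ : ∀ (F : Series n) c β' w N (o₂ : Offset) m →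
    (F ⊛ Run β' w c N 1 (bump o₂ w c)) m ≡ Σprefix c (λ j β'' → choose N (suc j) * (F ⊛ R β'' w c (bumpN w c (suc j) o₂)) m) β'
  Run-⊛ʳ F c β' w N o₂ m =
    trans (⊛-congʳ F _ (λ y → Σprefix c (λ j x → choose N (suc j) * R x w c (bumpN w c (suc j) o₂) y) β') m
             (λ y → Run≡Σprefix β' w c N 1 (bump o₂ w c) y))
      (trans (Σprefix-⊛ʳ c F (λ j x y → choose N (suc j) * R x w c (bumpN w c (suc j) o₂) y) β' m)
             (Σprefix-cong c _ _ β' (λ j x → ⊛-*ʳ (choose N (suc j)) F (R x w c (bumpN w c (suc j) o₂)) m)))

  Run-⊛ˡ : ∀ a α' v N (o₁ : Offset) (G : Series n) m →
    (Run α' v a N 1 (bump o₁ v a) ⊛ G) m ≡ Σprefix a (λ i α'' → choose N (suc i) * (R α'' v a (bumpN v a (suc i) o₁) ⊛ G) m) α'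
  Run-⊛ˡ a α' v N o₁ G m =
    trans (⊛-congˡ _ (λ y → Σprefix a (λ i x → choose N (suc i) * R x v a (bumpN v a (suc i) o₁) y) α') G m
                    (λ y → Run≡Σprefix α' v a N 1 (bump o₁ v a) y))
             (trans (Σprefix-⊛ˡ a (λ i x y → choose N (suc i) * R x v a (bumpN v a (suc i) o₁) y) α' G m)
                    (Σprefix-cong a _ _ α' (λ i x → ⊛-*ˡ (choose N (suc i)) (R x v a (bumpN v a (suc i) o₁)) G m)))

  R⧢ : List ℕ → List ℕ → ℕ → ℕ → Offset → Vec ℕ n → ℕ
  R⧢ α β v₀ a₀ o m = sum (map (λ γ → R γ v₀ a₀ o m) (shuffle α β))

  R⧢-cong : ∀ α β v a (o o' : Offset) m → (∀ x → o x ≡ o' x) → R⧢ α β v a o m ≡ R⧢ α β v a o' m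
  R⧢-cong α β v a o o' m h = sum-map-cong _ _ (shuffle α β) (λ γ → R-cong γ v a o o' m h)

  ProductFormulaBelow : ℕ → Set
  ProductFormulaBelow k = ∀ α β → length α + length β ≤ k → ∀ v₀ a₀ (o₁ o₂ : Offset) m →
    mults! (α ++ β) * (R α v₀ a₀ o₁ ⊛ R β v₀ a₀ o₂) m ≡ mults! α * mults! β * R⧢ α β v₀ a₀ (o₁ ⊕ o₂) m

  -- Two runs of the same weight a and value v, of lengths i and j, merge into one run of
  -- length i + j; rising-choose-identity converts the binomial weights.
  merged-run-product : ∀ k → ProductFormulaBelow k → ∀ a v i j α β → length α + length β ≤ k → ∀ (o₁ o₂ : Offset) m →
    mults! ((replicate i a ++ α) ++ (replicate j a ++ β))
      * (choose (i + mult a α) i * choose (j + mult a β) j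
          * (R α v a (bumpN v a i o₁) ⊛ R β v a (bumpN v a j o₂)) m)
    ≡ mults! (replicate i a ++ α) * mults! (replicate j a ++ β)
      * (choose (i + j) i * (choose (i + j + (mult a α + mult a β)) (i + j)
          * R⧢ α β v a (bumpN v a (i + j) (o₁ ⊕ o₂)) m))
  merged-run-product k ih a v i j α β len o₁ o₂ m = begin
      mults! ((replicate i a ++ α) ++ (replicate j a ++ β)) * (c₁ * c₂ * X)
        ≡⟨ cong (_* (c₁ * c₂ * X)) (mults!-merge-runs a i j α β) ⟩
      K * mults! (α ++ β) * (c₁ * c₂ * X)
        ≡⟨ regroup₁ K (mults! (α ++ β)) c₁ c₂ X ⟩
      K * (c₁ * c₂) * (mults! (α ++ β) * X)
        ≡⟨ cong₂ _*_ (rising-choose-identity i j M₁ M₂) (trans (ih α β len v a (bumpN v a i o₁) (bumpN v a j o₂) m)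
              (cong (mults! α * mults! β *_) (R⧢-cong α β v a _ _ m (bumpN-⊕ v a i j o₁ o₂)))) ⟩
      rising M₁ i * rising M₂ j * (cij * cN) * (mults! α * mults! β * S)
        ≡⟨ regroup₂ (rising M₁ i) (rising M₂ j) cij cN (mults! α) (mults! β) S ⟩
      rising M₁ i * mults! α * (rising M₂ j * mults! β) * (cij * (cN * S))
        ≡⟨ cong₂ (λ p q → p * q * (cij * (cN * S))) (sym (mults!-replicate a i α)) (sym (mults!-replicate a j β)) ⟩
      mults! (replicate i a ++ α) * mults! (replicate j a ++ β) * (cij * (cN * S)) ∎
    where
    open ≡-Reasoning
    M₁ = mult a α
    M₂ = mult a β
    c₁ = choose (i + M₁) i
    c₂ = choose (j + M₂) j
    cij = choose (i + j) i
    cN = choose (i + j + (M₁ + M₂)) (i + j)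
    X = (R α v a (bumpN v a i o₁) ⊛ R β v a (bumpN v a j o₂)) m
    S = R⧢ α β v a (bumpN v a (i + j) (o₁ ⊕ o₂)) m
    K = rising (M₁ + M₂) (i + j)
    regroup₁ : ∀ k l c d x → k * l * (c * d * x) ≡ k * (c * d) * (l * x)
    regroup₁ = solve-∀
    regroup₂ : ∀ f g c d p q s → f * g * (c * d) * (p * q * s) ≡ f * p * (g * q) * (c * (d * s))
    regroup₂ = solve-∀

  R∷-⊛ : ∀ a α' v₀ a₀ (o₁ : Offset) (G : Series n) m →
    (R (a ∷ α') v₀ a₀ o₁ ⊛ G) m ≡ sum (map (λ v → if after v a v₀ a₀ then (Run α' v a (suc (mult a α')) 1 (bump o₁ v a) ⊛ G) m else 0) vars)
  R∷-⊛ a α' v₀ a₀ o₁ G m =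
    trans (⊛-sumˡ (λ v x → if after v a v₀ a₀ then Run α' v a (suc (mult a α')) 1 (bump o₁ v a) x else 0) vars G m)
          (sum-map-cong _ _ vars (λ v → ⊛-ifˡ (after v a v₀ a₀) (Run α' v a (suc (mult a α')) 1 (bump o₁ v a)) G m))

  ⊛-R∷ : ∀ c β' v₀ a₀ (o₂ : Offset) (F : Series n) m →
    (F ⊛ R (c ∷ β') v₀ a₀ o₂) m ≡ sum (map (λ w → if after w c v₀ a₀ then (F ⊛ Run β' w c (suc (mult c β')) 1 (bump o₂ w c)) m else 0) vars)
  ⊛-R∷ c β' v₀ a₀ o₂ F m =
    trans (⊛-sumʳ F (λ w x → if after w c v₀ a₀ then Run β' w c (suc (mult c β')) 1 (bump o₂ w c) x else 0) vars m)
          (sum-map-cong _ _ vars (λ w → ⊛-ifʳ (after w c v₀ a₀) F (Run β' w c (suc (mult c β')) 1 (bump o₂ w c)) m))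

  R∷-⊛-R∷ : ∀ a α' c β' v₀ a₀ (o₁ o₂ : Offset) m →
    (R (a ∷ α') v₀ a₀ o₁ ⊛ R (c ∷ β') v₀ a₀ o₂) m
      ≡ sum (map (λ v → if after v a v₀ a₀ then (Run α' v a (suc (mult a α')) 1 (bump o₁ v a) ⊛ R (c ∷ β') v a o₂) m else 0) vars)
        + sum (map (λ w → if after w c v₀ a₀ then (R (a ∷ α') w c o₁ ⊛ Run β' w c (suc (mult c β')) 1 (bump o₂ w c)) m else 0) vars)
        + sum (map (λ v → if after v a v₀ a₀ then (if a ≡ᵇ c then (Run α' v a (suc (mult a α')) 1 (bump o₁ v a) ⊛ Run β' v c (suc (mult c β')) 1 (bump o₂ v c)) m else 0) else 0) vars)
  R∷-⊛-R∷ a α' c β' v₀ a₀ o₁ o₂ m = begin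
      (R (a ∷ α') v₀ a₀ o₁ ⊛ R (c ∷ β') v₀ a₀ o₂) m
        ≡⟨ R∷-⊛ a α' v₀ a₀ o₁ (R (c ∷ β') v₀ a₀ o₂) m ⟩
      sum (map (λ v → if T₁ v then (Zα v ⊛ R (c ∷ β') v₀ a₀ o₂) m else 0) vars)
        ≡⟨ sum-map-cong _ _ vars (λ v → trans (if-cong-then (T₁ v) (⊛-R∷ c β' v₀ a₀ o₂ (Zα v) m))
                                           (sym (sum-map-if (T₁ v) (λ w → if T₂ w then Q v w else 0) vars))) ⟩
      sum (map (λ v → sum (map (λ w → if T₁ v then (if T₂ w then Q v w else 0) else 0) vars)) vars)
        ≡⟨ sum-map-cong _ _ vars (λ v → trans (sum-map-cong _ _ vars (λ w → after-both v a w c v₀ a₀ (Q v w)))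
             (trans (sum-map-+ (λ w → byα v w + byβ v w) (tied v) vars) (cong (_+ sum (map (tied v) vars)) (sum-map-+ (byα v) (byβ v) vars)))) ⟩
      sum (map (λ v → sum (map (byα v) vars) + sum (map (byβ v) vars) + sum (map (tied v) vars)) vars)
        ≡⟨ trans (sum-map-+ (λ v → sum (map (byα v) vars) + sum (map (byβ v) vars)) (λ v → sum (map (tied v) vars)) vars)
                 (cong (_+ sum (map (λ v → sum (map (tied v) vars)) vars)) (sum-map-+ (λ v → sum (map (byα v) vars)) (λ v → sum (map (byβ v) vars)) vars)) ⟩
      sum (map (λ v → sum (map (byα v) vars)) vars) + sum (map (λ v → sum (map (byβ v) vars)) vars) + sum (map (λ v → sum (map (tied v) vars)) vars)
        ≡⟨ cong₂ _+_ (cong₂ _+_ first-α first-β) first-tied ⟩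
      _ ∎
    where
    open ≡-Reasoning
    T₁ : ℕ → Bool
    T₁ v = after v a v₀ a₀
    T₂ : ℕ → Bool
    T₂ w = after w c v₀ a₀
    Zα : ℕ → Series n
    Zα v = Run α' v a (suc (mult a α')) 1 (bump o₁ v a)
    Zβ : ℕ → Series n
    Zβ w = Run β' w c (suc (mult c β')) 1 (bump o₂ w c)
    Q : ℕ → ℕ → ℕ
    Q v w = (Zα v ⊛ Zβ w) m
    byα tied byβ : ℕ → ℕ → ℕ
    byα v w = if T₁ v then (if after w c v a then Q v w else 0) else 0
    byβ v w = if T₂ w then (if after v a w c then Q v w else 0) else 0
    tied v w = if T₁ v then (if (v ≡ᵇ w) ∧ (a ≡ᵇ c) then Q v w else 0) else 0
    first-α : sum (map (λ v → sum (map (byα v) vars)) vars) ≡ sum (map (λ v → if T₁ v then (Zα v ⊛ R (c ∷ β') v a o₂) m else 0) vars)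
    first-α = sum-map-cong _ _ vars (λ v → trans (sum-map-if (T₁ v) (λ w → if after w c v a then Q v w else 0) vars)
                                           (if-cong-then (T₁ v) (sym (⊛-R∷ c β' v a o₂ (Zα v) m))))
    first-β : sum (map (λ v → sum (map (byβ v) vars)) vars) ≡ sum (map (λ w → if T₂ w then (R (a ∷ α') w c o₁ ⊛ Zβ w) m else 0) vars)
    first-β = trans (sum-swap byβ vars vars) (sum-map-cong _ _ vars (λ w → trans (sum-map-if (T₂ w) (λ v → if after v a w c then Q v w else 0) vars)
                                           (if-cong-then (T₂ w) (sym (R∷-⊛ a α' w c o₁ (Zβ w) m)))))
    first-tied : sum (map (λ v → sum (map (tied v) vars)) vars) ≡ sum (map (λ v → if T₁ v then (if a ≡ᵇ c then Q v v else 0) else 0) vars)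
    first-tied = sum-upTo-cong n _ _ (λ v p → trans (sum-map-if (T₁ v) (λ w → if (v ≡ᵇ w) ∧ (a ≡ᵇ c) then Q v w else 0) vars)
                                           (if-cong-then (T₁ v) (sum-upTo-≡ᵇ n v (a ≡ᵇ c) (Q v) p)))

  Run⧢ : ℕ → ℕ → List ℕ → List ℕ → Offset → Vec ℕ n → ℕ
  Run⧢ ℓ v α' β o m = sum (map (λ γ' → Run γ' v ℓ (suc (mult ℓ γ')) 1 (bump o v ℓ) m) (shuffle α' β))

  R⧢-∷-∷ : ∀ a α' c β' v₀ a₀ (o : Offset) m →
    R⧢ (a ∷ α') (c ∷ β') v₀ a₀ o m
      ≡ sum (map (λ v → if after v a v₀ a₀ then Run⧢ a v α' (c ∷ β') o m else 0) vars)
        + sum (map (λ w → if after w c v₀ a₀ then Run⧢ c w (a ∷ α') β' o m else 0) vars)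
  R⧢-∷-∷ a α' c β' v₀ a₀ o m =
    trans (sum-map-++ (λ γ → R γ v₀ a₀ o m) (map (a ∷_) S₁) (map (c ∷_) S₂))
      (cong₂ _+_ (trans (sum-map-map (λ γ → R γ v₀ a₀ o m) (a ∷_) S₁) (first-part a α' (c ∷ β') S₁ refl))
                 (trans (sum-map-map (λ γ → R γ v₀ a₀ o m) (c ∷_) S₂) (first-part c (a ∷ α') β' S₂ refl)))
    where
    S₁ = shuffle α' (c ∷ β')
    S₂ = shuffle (a ∷ α') β'
    first-part : ∀ ℓ α'' β'' S → S ≡ shuffle α'' β'' →
      sum (map (λ γ' → R (ℓ ∷ γ') v₀ a₀ o m) S) ≡ sum (map (λ v → if after v ℓ v₀ a₀ then Run⧢ ℓ v α'' β'' o m else 0) vars)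
    first-part ℓ α'' β'' S refl = trans (sum-swap (λ γ' v → if after v ℓ v₀ a₀ then Run γ' v ℓ (suc (mult ℓ γ')) 1 (bump o v ℓ) m else 0) S vars)
      (sum-map-cong _ _ vars (λ v → sum-map-if (after v ℓ v₀ a₀) (λ γ' → Run γ' v ℓ (suc (mult ℓ γ')) 1 (bump o v ℓ) m) S))

  -- A closed run of length s taken from N copies of ℓ, followed by x.
  closedRun : ℕ → ℕ → ℕ → Offset → Vec ℕ n → ℕ → List ℕ → ℕ
  closedRun N ℓ v o m s x = choose N s * R x v ℓ (bumpN v ℓ s o) m

  sum-closedRun : ∀ N a v s α'' β'' (o : Offset) m → sum (map (closedRun N a v o m s) (shuffle α'' β'')) ≡ choose N s * R⧢ α'' β'' v a (bumpN v a s o) m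
  sum-closedRun N a v s α'' β'' o m = sum-map-* (choose N s) (λ x → R x v a (bumpN v a s o) m) (shuffle α'' β'')

  Run⧢≡Σprefix² : ∀ ℓ v α' β (o : Offset) m → Run⧢ ℓ v α' β o m ≡ Σprefix² ℓ (λ s → closedRun (suc (mult ℓ α' + mult ℓ β)) ℓ v o m (suc s)) α' β
  Run⧢≡Σprefix² ℓ v α' β o m = begin
      Run⧢ ℓ v α' β o m
        ≡⟨ sum-map-congAll _ _ (shuffle α' β) (All.map (λ {γ} p → cong (λ z → Run γ v ℓ (suc z) 1 (bump o v ℓ) m) (trans (mult-↭ ℓ p) (mult-++ ℓ α' β)))
                                                     (shuffle-↭ α' β)) ⟩
      sum (map (λ γ' → Run γ' v ℓ N 1 (bump o v ℓ) m) (shuffle α' β))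
        ≡⟨ sum-map-cong _ _ (shuffle α' β) (λ γ' → Run≡Σprefix γ' v ℓ N 1 (bump o v ℓ) m) ⟩
      sum (map (Σprefix ℓ (λ s → closedRun N ℓ v o m (suc s))) (shuffle α' β))
        ≡⟨ sum-shuffle-Σprefix ℓ (λ s → closedRun N ℓ v o m (suc s)) α' β ⟩
      Σprefix² ℓ (λ s → closedRun N ℓ v o m (suc s)) α' β ∎
    where
    open ≡-Reasoning
    N = suc (mult ℓ α' + mult ℓ β)
  -- The terms of Σprefix² with j = 0 and with j > 0: the first run of the shuffle takes no copy,
  -- or some copies, from the leading block of β.  Symmetrically on the right, with i.
  Run⧢-ownˡ : ℕ → ℕ → ℕ → List ℕ → List ℕ → Offset → Vec ℕ n → ℕ
  Run⧢-ownˡ N a v α' β o m = Σprefix a (λ i α'' → choose (i + 0) i * sum (map (closedRun N a v o m (suc (i + 0))) (shuffle α'' β))) α'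
  Run⧢-sharedˡ : ℕ → ℕ → ℕ → List ℕ → List ℕ → Offset → Vec ℕ n → ℕ
  Run⧢-sharedˡ N a v α' β' o m = Σprefix a (λ i α'' → Σprefix a (λ j β'' → choose (i + suc j) i * sum (map (closedRun N a v o m (suc (i + suc j))) (shuffle α'' β''))) β') α'

  Run⧢-splitˡ : ∀ a v α' c β' (o : Offset) m →
    Run⧢ a v α' (c ∷ β') o m ≡ Run⧢-ownˡ (suc (mult a α' + mult a (c ∷ β'))) a v α' (c ∷ β') o m
                            + (if c ≡ᵇ a then Run⧢-sharedˡ (suc (mult a α' + mult a (c ∷ β'))) a v α' β' o m else 0)
  Run⧢-splitˡ a v α' c β' o m = trans (Run⧢≡Σprefix² a v α' (c ∷ β') o m)
    (trans (Σprefix-+ a _ (λ i α'' → if c ≡ᵇ a then Σprefix a (λ j β'' → choose (i + suc j) i * sum (map (closedRun N a v o m (suc (i + suc j))) (shuffle α'' β''))) β' else 0) α')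
           (cong (Run⧢-ownˡ N a v α' (c ∷ β') o m +_) (Σprefix-if a (c ≡ᵇ a) _ α')))
    where N = suc (mult a α' + mult a (c ∷ β'))

  Run⧢-ownʳ : ℕ → ℕ → ℕ → List ℕ → List ℕ → Offset → Vec ℕ n → ℕ
  Run⧢-ownʳ N c w α β' o m = Σprefix c (λ j β'' → choose (0 + j) 0 * sum (map (closedRun N c w o m (suc (0 + j))) (shuffle α β''))) β'
  Run⧢-sharedʳ : ℕ → ℕ → ℕ → List ℕ → List ℕ → Offset → Vec ℕ n → ℕ
  Run⧢-sharedʳ N c w α' β' o m = Σprefix c (λ i α'' → Σprefix c (λ j β'' → choose (suc i + j) (suc i) * sum (map (closedRun N c w o m (suc (suc i + j))) (shuffle α'' β''))) β') α'

  Run⧢-splitʳ : ∀ c w a α' β' (o : Offset) m →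
    Run⧢ c w (a ∷ α') β' o m ≡ Run⧢-ownʳ (suc (mult c (a ∷ α') + mult c β')) c w (a ∷ α') β' o m
                            + (if a ≡ᵇ c then Run⧢-sharedʳ (suc (mult c (a ∷ α') + mult c β')) c w α' β' o m else 0)
  Run⧢-splitʳ c w a α' β' o m = Run⧢≡Σprefix² c w (a ∷ α') β' o m

  choose-+0-diag : ∀ i → choose (i + 0) i ≡ 1
  choose-+0-diag i = trans (cong (λ x → choose x i) (+-identityʳ i)) (choose-diag i)

  left-run-term : ∀ k → ProductFormulaBelow k → ∀ a v β (o₁ o₂ : Offset) m α₀ i α → α₀ ≡ replicate i a ++ α →
    suc (length α₀ + length β) ≤ suc k →
    mults! ((a ∷ α₀) ++ β) * (choose (suc (mult a α₀)) (suc i) * (R α v a (bumpN v a (suc i) o₁) ⊛ R β v a o₂) m)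
      ≡ mults! (a ∷ α₀) * mults! β * (choose (i + 0) i * sum (map (closedRun (suc (mult a α₀ + mult a β)) a v (o₁ ⊕ o₂) m (suc (i + 0))) (shuffle α β)))
  left-run-term k ih a v β o₁ o₂ m .(replicate i a ++ α) i α refl len = begin
      mults! ((a ∷ replicate i a ++ α) ++ β) * (choose (suc (mult a (replicate i a ++ α))) (suc i) * X)
        ≡⟨ cong (λ x → mults! ((a ∷ replicate i a ++ α) ++ β) * (choose (suc x) (suc i) * X)) (mult-replicate a i α) ⟩
      mults! ((a ∷ replicate i a ++ α) ++ β) * (choose (suc i + M₁) (suc i) * X)
        ≡⟨ cong (λ x → mults! ((a ∷ replicate i a ++ α) ++ β) * (x * X)) (sym (*-identityʳ (choose (suc i + M₁) (suc i)))) ⟩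
      mults! ((a ∷ replicate i a ++ α) ++ β) * (choose (suc i + M₁) (suc i) * 1 * X)
        ≡⟨ merged-run-product k ih a v (suc i) 0 α β shorter o₁ o₂ m ⟩
      mults! (a ∷ replicate i a ++ α) * mults! β
        * (choose (suc i + 0) (suc i) * (choose (suc i + 0 + (M₁ + M₂)) (suc i + 0) * R⧢ α β v a (bumpN v a (suc i + 0) (o₁ ⊕ o₂)) m))
        ≡⟨ cong (mults! (a ∷ replicate i a ++ α) * mults! β *_) (cong₂ _*_ (trans (choose-+0-diag (suc i)) (sym (choose-+0-diag i)))
             (trans (cong (λ x → choose x (suc (i + 0)) * R⧢ α β v a (bumpN v a (suc i + 0) (o₁ ⊕ o₂)) m) copies)
                    (sym (sum-closedRun N a v (suc (i + 0)) α β (o₁ ⊕ o₂) m)))) ⟩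
      mults! (a ∷ replicate i a ++ α) * mults! β * (choose (i + 0) i * sum (map (closedRun N a v (o₁ ⊕ o₂) m (suc (i + 0))) (shuffle α β))) ∎
    where
    open ≡-Reasoning
    M₁ = mult a α
    M₂ = mult a β
    X = (R α v a (bumpN v a (suc i) o₁) ⊛ R β v a o₂) m
    N = suc (mult a (replicate i a ++ α) + mult a β)
    copies : suc i + 0 + (M₁ + M₂) ≡ N
    copies = trans (cong suc (trans (cong (_+ (M₁ + M₂)) (+-identityʳ i)) (sym (+-assoc i M₁ M₂))))
                   (cong (λ x → suc (x + M₂)) (sym (mult-replicate a i α)))
    shorter : length α + length β ≤ k
    shorter = ≤-trans (+-monoˡ-≤ (length β) (m≤n+m (length α) i))
                (≤-trans (≤-reflexive (cong (_+ length β) (sym (length-replicate-++ a i α)))) (s≤s⁻¹ len))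

  -- The chain of α opens with a run of a at value v; the first entry of β comes strictly later.
  left-run-product : ∀ k → ProductFormulaBelow k → ∀ a α β v (o₁ o₂ : Offset) m → suc (length α + length β) ≤ suc k →
    mults! ((a ∷ α) ++ β) * (Run α v a (suc (mult a α)) 1 (bump o₁ v a) ⊛ R β v a o₂) m
      ≡ mults! (a ∷ α) * mults! β * Run⧢-ownˡ (suc (mult a α + mult a β)) a v α β (o₁ ⊕ o₂) m
  left-run-product k ih a α β v o₁ o₂ m len = begin
      L * (Run α v a (suc (mult a α)) 1 (bump o₁ v a) ⊛ R β v a o₂) m
        ≡⟨ cong (L *_) (Run-⊛ˡ a α v (suc (mult a α)) o₁ (R β v a o₂) m) ⟩
      L * Σprefix a (λ i α' → choose (suc (mult a α)) (suc i) * (R α' v a (bumpN v a (suc i) o₁) ⊛ R β v a o₂) m) α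
        ≡⟨ sym (Σprefix-* a L _ α) ⟩
      Σprefix a (λ i α' → L * (choose (suc (mult a α)) (suc i) * (R α' v a (bumpN v a (suc i) o₁) ⊛ R β v a o₂) m)) α
        ≡⟨ Σprefix-cong-local a _ _ α (λ i α' eq → left-run-term k ih a v β o₁ o₂ m α i α' eq len) ⟩
      Σprefix a (λ i α' → mults! (a ∷ α) * mults! β * (choose (i + 0) i * sum (map (closedRun N a v (o₁ ⊕ o₂) m (suc (i + 0))) (shuffle α' β)))) α
        ≡⟨ Σprefix-* a (mults! (a ∷ α) * mults! β) _ α ⟩
      mults! (a ∷ α) * mults! β * Run⧢-ownˡ N a v α β (o₁ ⊕ o₂) m ∎
    where
    open ≡-Reasoning
    L = mults! ((a ∷ α) ++ β)
    N = suc (mult a α + mult a β)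

  right-run-term : ∀ k → ProductFormulaBelow k → ∀ c α w (o₁ o₂ : Offset) m β₀ j β → β₀ ≡ replicate j c ++ β →
    length α + suc (length β₀) ≤ suc k →
    mults! (α ++ (c ∷ β₀)) * (choose (suc (mult c β₀)) (suc j) * (R α w c o₁ ⊛ R β w c (bumpN w c (suc j) o₂)) m)
      ≡ mults! α * mults! (c ∷ β₀) * (choose (0 + j) 0 * sum (map (closedRun (suc (mult c α + mult c β₀)) c w (o₁ ⊕ o₂) m (suc (0 + j))) (shuffle α β)))
  right-run-term k ih c α w o₁ o₂ m .(replicate j c ++ β) j β refl len = begin
      mults! (α ++ (c ∷ replicate j c ++ β)) * (choose (suc (mult c (replicate j c ++ β))) (suc j) * X)
        ≡⟨ cong (λ x → mults! (α ++ (c ∷ replicate j c ++ β)) * (choose (suc x) (suc j) * X)) (mult-replicate c j β) ⟩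
      mults! (α ++ (c ∷ replicate j c ++ β)) * (choose (suc j + M₂) (suc j) * X)
        ≡⟨ cong (λ x → mults! (α ++ (c ∷ replicate j c ++ β)) * (x * X)) (sym (*-identityˡ (choose (suc j + M₂) (suc j)))) ⟩
      mults! (α ++ (c ∷ replicate j c ++ β)) * (1 * choose (suc j + M₂) (suc j) * X)
        ≡⟨ merged-run-product k ih c w 0 (suc j) α β shorter o₁ o₂ m ⟩
      mults! α * mults! (c ∷ replicate j c ++ β) * (1 * (choose (suc (j + (M₁ + M₂))) (suc j) * R⧢ α β w c (bumpN w c (suc j) (o₁ ⊕ o₂)) m))
        ≡⟨ cong (λ x → mults! α * mults! (c ∷ replicate j c ++ β) * (1 * x))
             (trans (cong (λ x → choose x (suc j) * R⧢ α β w c (bumpN w c (suc j) (o₁ ⊕ o₂)) m) copies)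
                    (sym (sum-closedRun N c w (suc j) α β (o₁ ⊕ o₂) m))) ⟩
      mults! α * mults! (c ∷ replicate j c ++ β) * (1 * sum (map (closedRun N c w (o₁ ⊕ o₂) m (suc j)) (shuffle α β))) ∎
    where
    open ≡-Reasoning
    M₁ = mult c α
    M₂ = mult c β
    X = (R α w c o₁ ⊛ R β w c (bumpN w c (suc j) o₂)) m
    N = suc (mult c α + mult c (replicate j c ++ β))
    copies : suc (j + (M₁ + M₂)) ≡ N
    copies = cong suc (trans (trans (sym (+-assoc j M₁ M₂)) (trans (cong (_+ M₂) (+-comm j M₁)) (+-assoc M₁ j M₂)))
                             (cong (M₁ +_) (sym (mult-replicate c j β))))
    shorter : length α + length β ≤ k
    shorter = ≤-trans (+-monoʳ-≤ (length α) (m≤n+m (length β) j))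
                (≤-trans (≤-reflexive (cong (length α +_) (sym (length-replicate-++ c j β))))
                  (s≤s⁻¹ (≤-trans (≤-reflexive (sym (+-suc (length α) _))) len)))

  right-run-product : ∀ k → ProductFormulaBelow k → ∀ c α β w (o₁ o₂ : Offset) m → length α + suc (length β) ≤ suc k →
    mults! (α ++ (c ∷ β)) * (R α w c o₁ ⊛ Run β w c (suc (mult c β)) 1 (bump o₂ w c)) m
      ≡ mults! α * mults! (c ∷ β) * Run⧢-ownʳ (suc (mult c α + mult c β)) c w α β (o₁ ⊕ o₂) m
  right-run-product k ih c α β w o₁ o₂ m len = begin
      L * (R α w c o₁ ⊛ Run β w c (suc (mult c β)) 1 (bump o₂ w c)) m
        ≡⟨ cong (L *_) (Run-⊛ʳ (R α w c o₁) c β w (suc (mult c β)) o₂ m) ⟩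
      L * Σprefix c (λ j β' → choose (suc (mult c β)) (suc j) * (R α w c o₁ ⊛ R β' w c (bumpN w c (suc j) o₂)) m) β
        ≡⟨ sym (Σprefix-* c L _ β) ⟩
      Σprefix c (λ j β' → L * (choose (suc (mult c β)) (suc j) * (R α w c o₁ ⊛ R β' w c (bumpN w c (suc j) o₂)) m)) β
        ≡⟨ Σprefix-cong-local c _ _ β (λ j β' eq → right-run-term k ih c α w o₁ o₂ m β j β' eq len) ⟩
      Σprefix c (λ j β' → mults! α * mults! (c ∷ β) * (choose (0 + j) 0 * sum (map (closedRun N c w (o₁ ⊕ o₂) m (suc (0 + j))) (shuffle α β')))) β
        ≡⟨ Σprefix-* c (mults! α * mults! (c ∷ β)) _ β ⟩
      mults! α * mults! (c ∷ β) * Run⧢-ownʳ N c w α β (o₁ ⊕ o₂) m ∎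
    where
    open ≡-Reasoning
    L = mults! (α ++ (c ∷ β))
    N = suc (mult c α + mult c β)

  -- Pascal's rule on C(i + j + 2, i + 1) separates the merged runs whose first entry comes
  -- from α from those whose first entry comes from β.
  merged-run-pascal : ∀ a v (o : Offset) m i j α β →
    choose (suc i + suc j) (suc i) * (choose (suc i + suc j + (mult a α + mult a β)) (suc i + suc j) * R⧢ α β v a (bumpN v a (suc i + suc j) o) m)
      ≡ choose (i + suc j) i * sum (map (closedRun (suc (mult a (replicate i a ++ α) + mult a (a ∷ replicate j a ++ β))) a v o m (suc (i + suc j))) (shuffle α β))
        + choose (suc i + j) (suc i) * sum (map (closedRun (suc (mult a (a ∷ replicate i a ++ α) + mult a (replicate j a ++ β))) a v o m (suc (suc i + j))) (shuffle α β))
  merged-run-pascal a v o m i j α β = begin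
      choose (suc i + suc j) (suc i) * (choose M (suc i + suc j) * S)
        ≡⟨ *-distribʳ-+ (choose M (suc i + suc j) * S) (choose (i + suc j) i) (choose (i + suc j) (suc i)) ⟩
      choose (i + suc j) i * (choose M (suc i + suc j) * S) + choose (i + suc j) (suc i) * (choose M (suc i + suc j) * S)
        ≡⟨ cong₂ _+_ (cong (choose (i + suc j) i *_) (trans (cong (λ x → choose x (suc i + suc j) * S) M≡Nα)
                                                           (sym (sum-closedRun Nα a v (suc (i + suc j)) α β o m))))
                     (cong₂ _*_ (cong (λ x → choose x (suc i)) (+-suc i j))
                       (trans (cong₂ (λ x s → choose x s * S) M≡Nβ (cong suc (+-suc i j)))
                         (trans (cong (choose Nβ (suc (suc i + j)) *_) (R⧢-cong α β v a _ _ m (λ x → cong (λ t → bumpN v a t o x) (cong suc (+-suc i j)))))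
                                (sym (sum-closedRun Nβ a v (suc (suc i + j)) α β o m))))) ⟩
      choose (i + suc j) i * sum (map (closedRun Nα a v o m (suc (i + suc j))) (shuffle α β))
        + choose (suc i + j) (suc i) * sum (map (closedRun Nβ a v o m (suc (suc i + j))) (shuffle α β)) ∎
    where
    open ≡-Reasoning
    M₁ = mult a α
    M₂ = mult a β
    M = suc i + suc j + (M₁ + M₂)
    S = R⧢ α β v a (bumpN v a (suc i + suc j) o) m
    Nα = suc (mult a (replicate i a ++ α) + mult a (a ∷ replicate j a ++ β))
    Nβ = suc (mult a (a ∷ replicate i a ++ α) + mult a (replicate j a ++ β))
    regroupα : ∀ i j M₁ M₂ → suc i + suc j + (M₁ + M₂) ≡ suc (i + M₁ + suc (j + M₂))
    regroupα = solve-∀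
    regroupβ : ∀ i j M₁ M₂ → suc i + suc j + (M₁ + M₂) ≡ suc (suc (i + M₁) + (j + M₂))
    regroupβ = solve-∀
    M≡Nα : M ≡ Nα
    M≡Nα = trans (regroupα i j M₁ M₂) (cong suc (cong₂ _+_ (sym (mult-replicate a i α))
                   (sym (trans (mult-∷-self a (replicate j a ++ β)) (cong suc (mult-replicate a j β))))))
    M≡Nβ : M ≡ Nβ
    M≡Nβ = trans (regroupβ i j M₁ M₂) (cong suc (cong₂ _+_ (sym (trans (mult-∷-self a (replicate i a ++ α)) (cong suc (mult-replicate a i α))))
                   (sym (mult-replicate a j β))))

  shared-run-term : ∀ k → ProductFormulaBelow k → ∀ a v (o₁ o₂ : Offset) m α₀ β₀ i j α β →
    α₀ ≡ replicate i a ++ α → β₀ ≡ replicate j a ++ β → suc (length α₀) + suc (length β₀) ≤ suc k →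
    mults! ((a ∷ α₀) ++ (a ∷ β₀)) * (choose (suc (mult a α₀)) (suc i) * (choose (suc (mult a β₀)) (suc j)
        * (R α v a (bumpN v a (suc i) o₁) ⊛ R β v a (bumpN v a (suc j) o₂)) m))
      ≡ mults! (a ∷ α₀) * mults! (a ∷ β₀)
        * (choose (i + suc j) i * sum (map (closedRun (suc (mult a α₀ + mult a (a ∷ β₀))) a v (o₁ ⊕ o₂) m (suc (i + suc j))) (shuffle α β))
           + choose (suc i + j) (suc i) * sum (map (closedRun (suc (mult a (a ∷ α₀) + mult a β₀)) a v (o₁ ⊕ o₂) m (suc (suc i + j))) (shuffle α β)))
  shared-run-term k ih a v o₁ o₂ m .(replicate i a ++ α) .(replicate j a ++ β) i j α β refl refl len = begin
      L * (choose (suc (mult a (replicate i a ++ α))) (suc i) * (choose (suc (mult a (replicate j a ++ β))) (suc j) * X))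
        ≡⟨ cong₂ (λ p q → L * (choose (suc p) (suc i) * (choose (suc q) (suc j) * X))) (mult-replicate a i α) (mult-replicate a j β) ⟩
      L * (choose (suc i + mult a α) (suc i) * (choose (suc j + mult a β) (suc j) * X))
        ≡⟨ cong (L *_) (sym (*-assoc (choose (suc i + mult a α) (suc i)) _ X)) ⟩
      L * (choose (suc i + mult a α) (suc i) * choose (suc j + mult a β) (suc j) * X)
        ≡⟨ merged-run-product k ih a v (suc i) (suc j) α β shorter o₁ o₂ m ⟩
      Lα * Lβ * (choose (suc i + suc j) (suc i) * (choose (suc i + suc j + (mult a α + mult a β)) (suc i + suc j)
                 * R⧢ α β v a (bumpN v a (suc i + suc j) (o₁ ⊕ o₂)) m))
        ≡⟨ cong (Lα * Lβ *_) (merged-run-pascal a v (o₁ ⊕ o₂) m i j α β) ⟩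
      Lα * Lβ * _ ∎
    where
    open ≡-Reasoning
    L = mults! ((a ∷ replicate i a ++ α) ++ (a ∷ replicate j a ++ β))
    Lα = mults! (a ∷ replicate i a ++ α)
    Lβ = mults! (a ∷ replicate j a ++ β)
    X = (R α v a (bumpN v a (suc i) o₁) ⊛ R β v a (bumpN v a (suc j) o₂)) m
    shorter : length α + length β ≤ k
    shorter = ≤-trans (+-mono-≤ (m≤n+m (length α) i) (m≤n+m (length β) j))
                (≤-trans (≤-reflexive (cong₂ _+_ (sym (length-replicate-++ a i α)) (sym (length-replicate-++ a j β))))
                  (≤-trans (n≤1+n _) (s≤s⁻¹ (≤-trans (≤-reflexive (sym (+-suc (suc (length (replicate i a ++ α))) _))) len))))

  shared-run-product : ∀ k → ProductFormulaBelow k → ∀ a α β v (o₁ o₂ : Offset) m → suc (length α) + suc (length β) ≤ suc k →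
    mults! ((a ∷ α) ++ (a ∷ β)) * (Run α v a (suc (mult a α)) 1 (bump o₁ v a) ⊛ Run β v a (suc (mult a β)) 1 (bump o₂ v a)) m
      ≡ mults! (a ∷ α) * mults! (a ∷ β) * (Run⧢-sharedˡ (suc (mult a α + mult a (a ∷ β))) a v α β (o₁ ⊕ o₂) m
                                        + Run⧢-sharedʳ (suc (mult a (a ∷ α) + mult a β)) a v α β (o₁ ⊕ o₂) m)
  shared-run-product k ih a α β v o₁ o₂ m len = begin
      L * (Run α v a Nα₀ 1 (bump o₁ v a) ⊛ Run β v a Nβ₀ 1 (bump o₂ v a)) m
        ≡⟨ cong (L *_) expand ⟩
      L * Σprefix a (λ i α' → Σprefix a (λ j β' → term i j α' β') β) α
        ≡⟨ sym (Σprefix-* a L _ α) ⟩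
      Σprefix a (λ i α' → L * Σprefix a (λ j β' → term i j α' β') β) α
        ≡⟨ Σprefix-cong-local a _ _ α (λ i α' eqα → trans (sym (Σprefix-* a L _ β))
              (trans (Σprefix-cong-local a _ _ β (λ j β' eqβ → shared-run-term k ih a v o₁ o₂ m α β i j α' β' eqα eqβ len))
                     (Σprefix-* a (mults! (a ∷ α) * mults! (a ∷ β)) _ β))) ⟩
      Σprefix a (λ i α' → mults! (a ∷ α) * mults! (a ∷ β) * Σprefix a (λ j β' → fromα i α' j β' + fromβ i α' j β') β) α
        ≡⟨ Σprefix-* a (mults! (a ∷ α) * mults! (a ∷ β)) _ α ⟩
      mults! (a ∷ α) * mults! (a ∷ β) * Σprefix a (λ i α' → Σprefix a (λ j β' → fromα i α' j β' + fromβ i α' j β') β) α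
        ≡⟨ cong (mults! (a ∷ α) * mults! (a ∷ β) *_) (trans (Σprefix-cong a _ _ α (λ i α' → Σprefix-+ a (fromα i α') (fromβ i α') β))
                                                        (Σprefix-+ a (λ i α' → Σprefix a (fromα i α') β) (λ i α' → Σprefix a (fromβ i α') β) α)) ⟩
      mults! (a ∷ α) * mults! (a ∷ β) * (Run⧢-sharedˡ Nα a v α β o m + Run⧢-sharedʳ Nβ a v α β o m) ∎
    where
    open ≡-Reasoning
    o = o₁ ⊕ o₂
    L = mults! ((a ∷ α) ++ (a ∷ β))
    Nα₀ = suc (mult a α)
    Nβ₀ = suc (mult a β)
    Nα = suc (mult a α + mult a (a ∷ β))
    Nβ = suc (mult a (a ∷ α) + mult a β)
    term : ℕ → ℕ → List ℕ → List ℕ → ℕ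
    term i j α' β' = choose Nα₀ (suc i) * (choose Nβ₀ (suc j) * (R α' v a (bumpN v a (suc i) o₁) ⊛ R β' v a (bumpN v a (suc j) o₂)) m)
    fromα fromβ : ℕ → List ℕ → ℕ → List ℕ → ℕ
    fromα i α' j β' = choose (i + suc j) i * sum (map (closedRun Nα a v o m (suc (i + suc j))) (shuffle α' β'))
    fromβ i α' j β' = choose (suc i + j) (suc i) * sum (map (closedRun Nβ a v o m (suc (suc i + j))) (shuffle α' β'))
    expand : (Run α v a Nα₀ 1 (bump o₁ v a) ⊛ Run β v a Nβ₀ 1 (bump o₂ v a)) m ≡ Σprefix a (λ i α' → Σprefix a (λ j β' → term i j α' β') β) α
    expand = trans (Run-⊛ˡ a α v Nα₀ o₁ (Run β v a Nβ₀ 1 (bump o₂ v a)) m)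
      (Σprefix-cong a _ _ α (λ i α' → trans (cong (choose Nα₀ (suc i) *_) (Run-⊛ʳ (R α' v a (bumpN v a (suc i) o₁)) a β v Nβ₀ o₂ m))
                                            (sym (Σprefix-* a (choose Nα₀ (suc i)) _ β))))

  product-step-distinct : ∀ k → ProductFormulaBelow k → ∀ a α c β → (a ≡ᵇ c) ≡ false →
    suc (length α + suc (length β)) ≤ suc k → ∀ v₀ a₀ (o₁ o₂ : Offset) m →
    mults! ((a ∷ α) ++ (c ∷ β)) * (R (a ∷ α) v₀ a₀ o₁ ⊛ R (c ∷ β) v₀ a₀ o₂) m
      ≡ mults! (a ∷ α) * mults! (c ∷ β) * R⧢ (a ∷ α) (c ∷ β) v₀ a₀ (o₁ ⊕ o₂) m
  product-step-distinct k ih a α c β a≢c len v₀ a₀ o₁ o₂ m = begin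
      L * (R (a ∷ α) v₀ a₀ o₁ ⊛ R (c ∷ β) v₀ a₀ o₂) m
        ≡⟨ cong (L *_) (R∷-⊛-R∷ a α c β v₀ a₀ o₁ o₂ m) ⟩
      L * (firstα + firstβ + both)
        ≡⟨ cong (λ x → L * (firstα + firstβ + x)) (sum-map-zero _ vars (λ v → trans (if-cong-then (T₁ v) (if-cong a≢c)) (if-eta (T₁ v)))) ⟩
      L * (firstα + firstβ + 0)
        ≡⟨ trans (cong (L *_) (+-identityʳ _)) (*-distribˡ-+ L firstα firstβ) ⟩
      L * firstα + L * firstβ
        ≡⟨ cong₂ _+_ (trans (sum-map-*-if L T₁ _ vars) (sum-map-cong _ _ vars (λ v → if-cong-then (T₁ v) (left-run-product k ih a α (c ∷ β) v o₁ o₂ m len))))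
                     (trans (sum-map-*-if L T₂ _ vars) (sum-map-cong _ _ vars (λ w → if-cong-then (T₂ w) (right-run-product k ih c (a ∷ α) β w o₁ o₂ m len)))) ⟩
      sum (map (λ v → if T₁ v then Lαβ * Run⧢-ownˡ Nα a v α (c ∷ β) o m else 0) vars)
        + sum (map (λ w → if T₂ w then Lαβ * Run⧢-ownʳ Nβ c w (a ∷ α) β o m else 0) vars)
        ≡⟨ trans (cong₂ _+_ (sym (sum-map-*-if Lαβ T₁ _ vars)) (sym (sum-map-*-if Lαβ T₂ _ vars))) (sym (*-distribˡ-+ Lαβ _ _)) ⟩
      Lαβ * (sum (map (λ v → if T₁ v then Run⧢-ownˡ Nα a v α (c ∷ β) o m else 0) vars)
             + sum (map (λ w → if T₂ w then Run⧢-ownʳ Nβ c w (a ∷ α) β o m else 0) vars))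
        ≡⟨ cong (Lαβ *_) (sym (cong₂ _+_
             (sum-map-cong _ _ vars (λ v → if-cong-then (T₁ v) (trans (Run⧢-splitˡ a v α c β o m)
                (trans (cong (Run⧢-ownˡ Nα a v α (c ∷ β) o m +_) (if-cong (trans (≡ᵇ-sym c a) a≢c))) (+-identityʳ _)))))
             (sum-map-cong _ _ vars (λ w → if-cong-then (T₂ w) (trans (Run⧢-splitʳ c w a α β o m)
                (trans (cong (Run⧢-ownʳ Nβ c w (a ∷ α) β o m +_) (if-cong a≢c)) (+-identityʳ _))))))) ⟩
      Lαβ * (sum (map (λ v → if T₁ v then Run⧢ a v α (c ∷ β) o m else 0) vars)
             + sum (map (λ w → if T₂ w then Run⧢ c w (a ∷ α) β o m else 0) vars))
        ≡⟨ cong (Lαβ *_) (sym (R⧢-∷-∷ a α c β v₀ a₀ o m)) ⟩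
      Lαβ * R⧢ (a ∷ α) (c ∷ β) v₀ a₀ o m ∎
    where
    open ≡-Reasoning
    o = o₁ ⊕ o₂
    L = mults! ((a ∷ α) ++ (c ∷ β))
    Lαβ = mults! (a ∷ α) * mults! (c ∷ β)
    T₁ T₂ : ℕ → Bool
    T₁ v = after v a v₀ a₀
    T₂ w = after w c v₀ a₀
    Nα = suc (mult a α + mult a (c ∷ β))
    Nβ = suc (mult c (a ∷ α) + mult c β)
    firstα = sum (map (λ v → if T₁ v then (Run α v a (suc (mult a α)) 1 (bump o₁ v a) ⊛ R (c ∷ β) v a o₂) m else 0) vars)
    firstβ = sum (map (λ w → if T₂ w then (R (a ∷ α) w c o₁ ⊛ Run β w c (suc (mult c β)) 1 (bump o₂ w c)) m else 0) vars)
    both = sum (map (λ v → if T₁ v then (if a ≡ᵇ c then (Run α v a (suc (mult a α)) 1 (bump o₁ v a) ⊛ Run β v c (suc (mult c β)) 1 (bump o₂ v c)) m else 0) else 0) vars)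

  first-run-product : ∀ k → ProductFormulaBelow k → ∀ a α β v (o₁ o₂ : Offset) m → suc (length α + suc (length β)) ≤ suc k →
    mults! ((a ∷ α) ++ (a ∷ β)) * ((Run α v a (suc (mult a α)) 1 (bump o₁ v a) ⊛ R (a ∷ β) v a o₂) m
                                   + (R (a ∷ α) v a o₁ ⊛ Run β v a (suc (mult a β)) 1 (bump o₂ v a)) m
                                   + (Run α v a (suc (mult a α)) 1 (bump o₁ v a) ⊛ Run β v a (suc (mult a β)) 1 (bump o₂ v a)) m)
      ≡ mults! (a ∷ α) * mults! (a ∷ β) * (Run⧢ a v α (a ∷ β) (o₁ ⊕ o₂) m + Run⧢ a v (a ∷ α) β (o₁ ⊕ o₂) m)
  first-run-product k ih a α β v o₁ o₂ m len = begin
      L * (Pα + Pβ + Pαβ)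
        ≡⟨ trans (*-distribˡ-+ L (Pα + Pβ) Pαβ) (cong (_+ L * Pαβ) (*-distribˡ-+ L Pα Pβ)) ⟩
      L * Pα + L * Pβ + L * Pαβ
        ≡⟨ cong₂ _+_ (cong₂ _+_ (left-run-product k ih a α (a ∷ β) v o₁ o₂ m len) (right-run-product k ih a (a ∷ α) β v o₁ o₂ m len))
                     (shared-run-product k ih a α β v o₁ o₂ m len) ⟩
      Lαβ * ownα + Lαβ * ownβ + Lαβ * (sharedα + sharedβ)
        ≡⟨ regroup Lαβ ownα ownβ sharedα sharedβ ⟩
      Lαβ * ((ownα + sharedα) + (ownβ + sharedβ))
        ≡⟨ cong (Lαβ *_) (sym (cong₂ _+_ (trans (Run⧢-splitˡ a v α a β o m) (cong (ownα +_) (if-cong (≡ᵇ-refl a))))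
                                         (trans (Run⧢-splitʳ a v a α β o m) (cong (ownβ +_) (if-cong (≡ᵇ-refl a)))))) ⟩
      Lαβ * (Run⧢ a v α (a ∷ β) o m + Run⧢ a v (a ∷ α) β o m) ∎
    where
    open ≡-Reasoning
    o = o₁ ⊕ o₂
    L = mults! ((a ∷ α) ++ (a ∷ β))
    Lαβ = mults! (a ∷ α) * mults! (a ∷ β)
    Pα = (Run α v a (suc (mult a α)) 1 (bump o₁ v a) ⊛ R (a ∷ β) v a o₂) m
    Pβ = (R (a ∷ α) v a o₁ ⊛ Run β v a (suc (mult a β)) 1 (bump o₂ v a)) m
    Pαβ = (Run α v a (suc (mult a α)) 1 (bump o₁ v a) ⊛ Run β v a (suc (mult a β)) 1 (bump o₂ v a)) m
    Nα = suc (mult a α + mult a (a ∷ β))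
    Nβ = suc (mult a (a ∷ α) + mult a β)
    ownα = Run⧢-ownˡ Nα a v α (a ∷ β) o m
    ownβ = Run⧢-ownʳ Nβ a v (a ∷ α) β o m
    sharedα = Run⧢-sharedˡ Nα a v α β o m
    sharedβ = Run⧢-sharedʳ Nβ a v α β o m
    regroup : ∀ l p q r s → l * p + l * q + l * (r + s) ≡ l * ((p + r) + (q + s))
    regroup = solve-∀

  product-step-same : ∀ k → ProductFormulaBelow k → ∀ a α β → suc (length α + suc (length β)) ≤ suc k →
    ∀ v₀ a₀ (o₁ o₂ : Offset) m →
    mults! ((a ∷ α) ++ (a ∷ β)) * (R (a ∷ α) v₀ a₀ o₁ ⊛ R (a ∷ β) v₀ a₀ o₂) m
      ≡ mults! (a ∷ α) * mults! (a ∷ β) * R⧢ (a ∷ α) (a ∷ β) v₀ a₀ (o₁ ⊕ o₂) m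
  product-step-same k ih a α β len v₀ a₀ o₁ o₂ m = begin
      L * (R (a ∷ α) v₀ a₀ o₁ ⊛ R (a ∷ β) v₀ a₀ o₂) m
        ≡⟨ cong (L *_) (R∷-⊛-R∷ a α a β v₀ a₀ o₁ o₂ m) ⟩
      L * (sum (map (λ v → if T v then Pα v else 0) vars) + sum (map (λ v → if T v then Pβ v else 0) vars) + both)
        ≡⟨ cong (L *_) (trans (cong (_+ both) (sym (sum-map-+ _ _ vars))) (sym (sum-map-+ _ _ vars))) ⟩
      L * sum (map (λ v → (if T v then Pα v else 0) + (if T v then Pβ v else 0) + (if T v then (if a ≡ᵇ a then Pαβ v else 0) else 0)) vars)
        ≡⟨ cong (L *_) (sum-map-cong _ _ vars (λ v → collect (T v) (Pα v) (Pβ v) (Pαβ v))) ⟩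
      L * sum (map (λ v → if T v then Pα v + Pβ v + Pαβ v else 0) vars)
        ≡⟨ sum-map-*-if L T _ vars ⟩
      sum (map (λ v → if T v then L * (Pα v + Pβ v + Pαβ v) else 0) vars)
        ≡⟨ sum-map-cong _ _ vars (λ v → if-cong-then (T v) (first-run-product k ih a α β v o₁ o₂ m len)) ⟩
      sum (map (λ v → if T v then Lαβ * (Run⧢ a v α (a ∷ β) o m + Run⧢ a v (a ∷ α) β o m) else 0) vars)
        ≡⟨ sym (sum-map-*-if Lαβ T _ vars) ⟩
      Lαβ * sum (map (λ v → if T v then Run⧢ a v α (a ∷ β) o m + Run⧢ a v (a ∷ α) β o m else 0) vars)
        ≡⟨ cong (Lαβ *_) (trans (sum-map-cong _ _ vars (λ v → if-+ (T v) _ _)) (sum-map-+ _ _ vars)) ⟩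
      Lαβ * (sum (map (λ v → if T v then Run⧢ a v α (a ∷ β) o m else 0) vars)
             + sum (map (λ w → if T w then Run⧢ a w (a ∷ α) β o m else 0) vars))
        ≡⟨ cong (Lαβ *_) (sym (R⧢-∷-∷ a α a β v₀ a₀ o m)) ⟩
      Lαβ * R⧢ (a ∷ α) (a ∷ β) v₀ a₀ o m ∎
    where
    open ≡-Reasoning
    o = o₁ ⊕ o₂
    L = mults! ((a ∷ α) ++ (a ∷ β))
    Lαβ = mults! (a ∷ α) * mults! (a ∷ β)
    T : ℕ → Bool
    T v = after v a v₀ a₀
    Pα Pβ Pαβ : ℕ → ℕ
    Pα v = (Run α v a (suc (mult a α)) 1 (bump o₁ v a) ⊛ R (a ∷ β) v a o₂) m
    Pβ w = (R (a ∷ α) w a o₁ ⊛ Run β w a (suc (mult a β)) 1 (bump o₂ w a)) m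
    Pαβ v = (Run α v a (suc (mult a α)) 1 (bump o₁ v a) ⊛ Run β v a (suc (mult a β)) 1 (bump o₂ v a)) m
    both = sum (map (λ v → if T v then (if a ≡ᵇ a then Pαβ v else 0) else 0) vars)
    collect : ∀ (t : Bool) p q r → (if t then p else 0) + (if t then q else 0) + (if t then (if a ≡ᵇ a then r else 0) else 0)
                                   ≡ (if t then p + q + r else 0)
    collect true p q r rewrite ≡ᵇ-refl a = refl
    collect false p q r = refl

  product-formula : ∀ k → ProductFormulaBelow k
  product-formula k [] β len v₀ a₀ o₁ o₂ m = trans (cong (mults! β *_) (x^-⊛-R β v₀ a₀ o₁ o₂ m)) (regroup (mults! β) (R β v₀ a₀ (o₁ ⊕ o₂) m))
    where
    regroup : ∀ l x → l * x ≡ (l + 0) * (x + 0)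
    regroup = solve-∀
  product-formula k (x ∷ xs) [] len v₀ a₀ o₁ o₂ m =
    trans (cong₂ _*_ (cong mults! (++-identityʳ (x ∷ xs))) (R-⊛-x^ (x ∷ xs) v₀ a₀ o₁ o₂ m)) (regroup (mults! (x ∷ xs)) (R (x ∷ xs) v₀ a₀ (o₁ ⊕ o₂) m))
    where
    regroup : ∀ l x → l * x ≡ l * 1 * (x + 0)
    regroup = solve-∀
  product-formula zero (a ∷ α) (c ∷ β) ()
  product-formula (suc k) (a ∷ α) (c ∷ β) len with a ≡ᵇ c in e
  ... | false = product-step-distinct k (product-formula k) a α c β e len
  ... | true with refl ← ≡ᵇ-true⇒≡ a c e = product-step-same k (product-formula k) a α β len

-- Chains

Compatible : Entry → Entry → Set
Compatible ((a , k) , v) ((a' , k') , v') = v < v' ⊎ (v ≡ v' × (a' < a ⊎ (a ≡ a' × k' < k)))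

compatible-sound : ∀ e e' → compatible e e' ≡ true → Compatible e e'
compatible-sound ((a , k) , v) ((a' , k') , v') e with ∧-true⇒× (v ≤ᵇ v') _ e
... | p , q with ∨-true⇒⊎ (not (v ≡ᵇ v')) _ q
...   | inj₁ r = inj₁ (≤∧≢⇒< (≤ᵇ-true⇒≤ v v' p) (≡ᵇ-false⇒≢ v v' (not-true r)))
  where
  not-true : ∀ {x} → not x ≡ true → x ≡ false
  not-true {false} _ = refl
...   | inj₂ r with v ≡ᵇ v' in ev
...     | false = inj₁ (≤∧≢⇒< (≤ᵇ-true⇒≤ v v' p) (≡ᵇ-false⇒≢ v v' ev))
...     | true with ∨-true⇒⊎ (a' <ᵇ a) _ r
...       | inj₁ s = inj₂ (≡ᵇ-true⇒≡ v v' ev , inj₁ (<ᵇ-true⇒< a' a s))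
...       | inj₂ s with ∧-true⇒× (a ≡ᵇ a') _ s
...         | s₁ , s₂ = inj₂ (≡ᵇ-true⇒≡ v v' ev , inj₂ (≡ᵇ-true⇒≡ a a' s₁ , <ᵇ-true⇒< k' k s₂))

compatible-complete : ∀ e e' → Compatible e e' → compatible e e' ≡ true
compatible-complete ((a , k) , v) ((a' , k') , v') (inj₁ p)
  rewrite ≤⇒≤ᵇ-true (<⇒≤ p) | ≢⇒≡ᵇ-false (<⇒≢ p) = refl
compatible-complete ((a , k) , v) ((a' , k') , .v) (inj₂ (refl , inj₁ p))
  rewrite ≤⇒≤ᵇ-true (≤-refl {v}) | ≡ᵇ-refl v | <⇒<ᵇ-true p = refl
compatible-complete ((a , k) , v) ((.a , k') , .v) (inj₂ (refl , inj₂ (refl , p)))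
  rewrite ≤⇒≤ᵇ-true (≤-refl {v}) | ≡ᵇ-refl v | ≡ᵇ-refl a | <⇒<ᵇ-true p = ∨-zeroʳ (a <ᵇ a)

Compatible-trans : ∀ x y z → Compatible x y → Compatible y z → Compatible x z
Compatible-trans _ _ _ (inj₁ p) (inj₁ q) = inj₁ (<-trans p q)
Compatible-trans _ _ _ (inj₁ p) (inj₂ (refl , q)) = inj₁ p
Compatible-trans _ _ _ (inj₂ (refl , p)) (inj₁ q) = inj₁ q
Compatible-trans _ _ _ (inj₂ (refl , inj₁ p)) (inj₂ (refl , inj₁ q)) = inj₂ (refl , inj₁ (<-trans q p))
Compatible-trans _ _ _ (inj₂ (refl , inj₁ p)) (inj₂ (refl , inj₂ (refl , q))) = inj₂ (refl , inj₁ p)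
Compatible-trans _ _ _ (inj₂ (refl , inj₂ (refl , p))) (inj₂ (refl , inj₁ q)) = inj₂ (refl , inj₁ q)
Compatible-trans _ _ _ (inj₂ (refl , inj₂ (refl , p))) (inj₂ (refl , inj₂ (refl , q))) = inj₂ (refl , inj₂ (refl , <-trans q p))

compatible-trans : ∀ x y z → compatible x y ≡ true → compatible y z ≡ true → compatible x z ≡ true
compatible-trans x y z p q = compatible-complete x z (Compatible-trans x y z (compatible-sound x y p) (compatible-sound y z q))

allB-compatible-trans : ∀ b e (t : List Entry) → compatible b e ≡ true → allB (compatible e) t ≡ true → allB (compatible b) t ≡ true
allB-compatible-trans b e [] p q = refl
allB-compatible-trans b e (x ∷ t) p q with ∧-true⇒× (compatible e x) _ q
... | q₁ , q₂ rewrite compatible-trans b e x p q₁ = allB-compatible-trans b e t p q₂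

allB-∧ : ∀ {A : Set} (f g : A → Bool) (t : List A) → allB (λ e → f e ∧ g e) t ≡ (allB f t ∧ allB g t)
allB-∧ f g [] = refl
allB-∧ f g (x ∷ t) rewrite allB-∧ f g t with f x | g x
... | true | true = refl
... | true | false = sym (∧-zeroʳ (allB f t))
... | false | _ = refl

compatible-after : ∀ a₀ k₀ v₀ a k v → after v a v₀ a₀ ≡ true → compatible ((a₀ , k₀) , v₀) ((a , k) , v) ≡ true
compatible-after a₀ k₀ v₀ a k v e with after-sound v a v₀ a₀ e
... | inj₁ p = compatible-complete ((a₀ , k₀) , v₀) ((a , k) , v) (inj₁ p)
... | inj₂ (p , q) = compatible-complete ((a₀ , k₀) , v₀) ((a , k) , v) (inj₂ (p , inj₁ q))

compatible-same-tag : ∀ a k₀ k v → compatible ((a , k₀) , v) ((a , k) , v) ≡ (k <ᵇ k₀)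
compatible-same-tag a k₀ k v rewrite ≤⇒≤ᵇ-true (≤-refl {v}) | ≡ᵇ-refl v | ≤⇒<ᵇ-false (≤-refl {a}) | ≡ᵇ-refl a = refl

incompatible-otherwise : ∀ a₀ k₀ v₀ a k v → after v a v₀ a₀ ≡ false → ((v ≡ᵇ v₀) ∧ (a ≡ᵇ a₀)) ≡ false →
  compatible ((a₀ , k₀) , v₀) ((a , k) , v) ≡ false
incompatible-otherwise a₀ k₀ v₀ a k v e₁ e₂ with compatible ((a₀ , k₀) , v₀) ((a , k) , v) in e
... | false = refl
... | true with compatible-sound ((a₀ , k₀) , v₀) ((a , k) , v) e
...   | inj₁ p with () ← trans (sym e₁) (after-complete v a v₀ a₀ (inj₁ p))
...   | inj₂ (refl , inj₁ p) with () ← trans (sym e₁) (after-complete v a v₀ a₀ (inj₂ (refl , p)))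
...   | inj₂ (refl , inj₂ (refl , p)) with () ← trans (sym e₂) (cong₂ _∧_ (≡ᵇ-refl v₀) (≡ᵇ-refl a₀))

sum-words-suc : ∀ (F : List ℕ → ℕ) ℓ X → sum (map F (words (suc ℓ) X)) ≡ sum (map (λ x → sum (map (λ w → F (x ∷ w)) (words ℓ X))) X)
sum-words-suc F ℓ X = trans (sum-concatMap F (λ x → map (x ∷_) (words ℓ X)) X) (sum-map-cong _ _ X (λ x → sum-map-map F (x ∷_) (words ℓ X)))

∧-falseʳ : ∀ x {y} → y ≡ false → (x ∧ y) ≡ false
∧-falseʳ x refl = ∧-zeroʳ x

countB-cong : ∀ {A : Set} (f g : A → Bool) xs → (∀ x → f x ≡ g x) → countB f xs ≡ countB g xs
countB-cong f g [] h = refl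
countB-cong f g (x ∷ xs) h = cong₂ _+_ (cong 𝟙 (h x)) (countB-cong f g xs h)

countB-false : ∀ {A : Set} (f : A → Bool) xs → All (λ x → f x ≡ false) xs → countB f xs ≡ 0
countB-false f [] [] = refl
countB-false f (x ∷ xs) (h ∷ hs) rewrite h = countB-false f xs hs

-- Reindexing by rank: the labels allowed by p, in increasing order, have ranks 0, 1, 2, …
sum-by-rank : ∀ D → AllPairs _<_ D → ∀ (p : ℕ → Bool) (g : ℕ → ℕ) →
  sum (map (λ k → 𝟙 (p k) * g (countB (λ k' → p k' ∧ (k' <ᵇ k)) D)) D) ≡ sumTo (countB p D) g
sum-by-rank [] [] p g = refl
sum-by-rank (d ∷ D) (d<D ∷ inc) p g = begin
    𝟙 (p d) * g (countB (λ k' → p k' ∧ (k' <ᵇ d)) (d ∷ D)) + sum (map (λ k → 𝟙 (p k) * g (countB (λ k' → p k' ∧ (k' <ᵇ k)) (d ∷ D))) D)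
      ≡⟨ cong₂ (λ u w → 𝟙 (p d) * g u + w) rank-d (sum-map-congAll _ _ D (All.map (λ {k} q → cong (λ z → 𝟙 (p k) * g z) (rank-above k q)) d<D)) ⟩
    𝟙 (p d) * g 0 + sum (map (λ k → 𝟙 (p k) * g (𝟙 (p d) + countB (λ k' → p k' ∧ (k' <ᵇ k)) D)) D)
      ≡⟨ cong (𝟙 (p d) * g 0 +_) (sum-by-rank D inc p (λ j → g (𝟙 (p d) + j))) ⟩
    𝟙 (p d) * g 0 + sumTo (countB p D) (λ j → g (𝟙 (p d) + j))
      ≡⟨ shift (p d) ⟩
    sumTo (𝟙 (p d) + countB p D) g ∎
  where
  open ≡-Reasoning
  rank-d : countB (λ k' → p k' ∧ (k' <ᵇ d)) (d ∷ D) ≡ 0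
  rank-d = cong₂ _+_ (cong 𝟙 (∧-falseʳ (p d) (≤⇒<ᵇ-false (≤-refl {d}))))
                     (countB-false _ D (All.map (λ {k'} q → ∧-falseʳ (p k') (≤⇒<ᵇ-false (<⇒≤ q))) d<D))
  rank-above : ∀ k → d < k → countB (λ k' → p k' ∧ (k' <ᵇ k)) (d ∷ D) ≡ 𝟙 (p d) + countB (λ k' → p k' ∧ (k' <ᵇ k)) D
  rank-above k q rewrite <⇒<ᵇ-true q with p d
  ... | true = refl
  ... | false = refl
  shift : ∀ b → 𝟙 b * g 0 + sumTo (countB p D) (λ j → g (𝟙 b + j)) ≡ sumTo (𝟙 b + countB p D) g
  shift true = cong (_+ sumTo (countB p D) (λ j → g (suc j))) (+-identityʳ (g 0))
  shift false = refl

sum-by-rank-below : ∀ D → AllPairs _<_ D → ∀ (p : ℕ → Bool) (g : ℕ → ℕ) k₀ →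
  sum (map (λ k → 𝟙 (p k ∧ (k <ᵇ k₀)) * g (countB (λ k' → p k' ∧ (k' <ᵇ k)) D)) D) ≡ sumTo (countB (λ k → p k ∧ (k <ᵇ k₀)) D) g
sum-by-rank-below D inc p g k₀ = trans (sum-map-cong _ _ D same-rank) (sum-by-rank D inc (λ k → p k ∧ (k <ᵇ k₀)) g)
  where
  same-rank : ∀ k → 𝟙 (p k ∧ (k <ᵇ k₀)) * g (countB (λ k' → p k' ∧ (k' <ᵇ k)) D)
                  ≡ 𝟙 (p k ∧ (k <ᵇ k₀)) * g (countB (λ k' → (p k' ∧ (k' <ᵇ k₀)) ∧ (k' <ᵇ k)) D)
  same-rank k with p k ∧ (k <ᵇ k₀) in e
  ... | false = refl
  ... | true = cong (λ z → 1 * g z) (countB-cong _ _ D below-k)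
    where
    k<k₀ : k < k₀
    k<k₀ = <ᵇ-true⇒< k k₀ (proj₂ (∧-true⇒× (p k) _ e))
    below-k : ∀ k' → (p k' ∧ (k' <ᵇ k)) ≡ ((p k' ∧ (k' <ᵇ k₀)) ∧ (k' <ᵇ k))
    below-k k' with k' <ᵇ k in e'
    ... | false = trans (∧-zeroʳ (p k')) (sym (∧-zeroʳ (p k' ∧ (k' <ᵇ k₀))))
    ... | true rewrite <⇒<ᵇ-true (<-trans (<ᵇ-true⇒< k' k e') k<k₀) = sym (∧-identityʳ _)

countB-≡ᵇ-once : ∀ D → AllPairs _<_ D → All (λ k → countB (k ≡ᵇ_) D ≡ 1) D
countB-≡ᵇ-once [] [] = []
countB-≡ᵇ-once (d ∷ D) (d<D ∷ inc) =
  cong₂ _+_ (cong 𝟙 (≡ᵇ-refl d)) (countB-false _ D (All.map (λ q → ≢⇒≡ᵇ-false (<⇒≢ q)) d<D))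
  ∷ All.zipWith (λ { {k} (q , h) → trans (cong (λ b → 𝟙 b + countB (k ≡ᵇ_) D) (≢⇒≡ᵇ-false (≢-sym (<⇒≢ q)))) h })
                (d<D , countB-≡ᵇ-once D inc)

countB-remove : ∀ (p : ℕ → Bool) k D → countB (λ k' → p k' ∧ not (k ≡ᵇ k')) D + 𝟙 (p k) * countB (k ≡ᵇ_) D ≡ countB p D
countB-remove p k [] = *-zeroʳ (𝟙 (p k))
countB-remove p k (d ∷ D) = begin
    𝟙 (p d ∧ not (k ≡ᵇ d)) + C + 𝟙 (p k) * (𝟙 (k ≡ᵇ d) + countB (k ≡ᵇ_) D)
      ≡⟨ cong (𝟙 (p d ∧ not (k ≡ᵇ d)) + C +_) (*-distribˡ-+ (𝟙 (p k)) (𝟙 (k ≡ᵇ d)) _) ⟩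
    𝟙 (p d ∧ not (k ≡ᵇ d)) + C + (𝟙 (p k) * 𝟙 (k ≡ᵇ d) + 𝟙 (p k) * countB (k ≡ᵇ_) D)
      ≡⟨ +-interchange (𝟙 (p d ∧ not (k ≡ᵇ d))) C (𝟙 (p k) * 𝟙 (k ≡ᵇ d)) (𝟙 (p k) * countB (k ≡ᵇ_) D) ⟩
    (𝟙 (p d ∧ not (k ≡ᵇ d)) + 𝟙 (p k) * 𝟙 (k ≡ᵇ d)) + (C + 𝟙 (p k) * countB (k ≡ᵇ_) D)
      ≡⟨ cong₂ _+_ head (countB-remove p k D) ⟩
    𝟙 (p d) + countB p D ∎
  where
  open ≡-Reasoning
  C = countB (λ k' → p k' ∧ not (k ≡ᵇ k')) D
  head : 𝟙 (p d ∧ not (k ≡ᵇ d)) + 𝟙 (p k) * 𝟙 (k ≡ᵇ d) ≡ 𝟙 (p d)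
  head with k ≡ᵇ d in e
  ... | true rewrite ≡ᵇ-true⇒≡ k d e with p d
  ...   | true = refl
  ...   | false = refl
  head | false with p d
  ... | true = cong suc (*-zeroʳ (𝟙 (p k)))
  ... | false = *-zeroʳ (𝟙 (p k))

module RankedRuns (n : ℕ) where
  open RunCount n

  -- As R, except that a further entry with the tag of the last one is allowed, provided its
  -- label is one of the j₀ admissible labels below the last label.
  Rrank : List ℕ → ℕ → ℕ → ℕ → Offset → Vec ℕ n → ℕ
  Rrank [] v₀ a₀ j₀ o m = x^ o m
  Rrank (a ∷ α) v₀ a₀ j₀ o m = sum (map (λ v → if after v a v₀ a₀ then sumTo (suc (mult a α)) (λ j → Rrank α v a j (bump o v a) m)
                                         else (if (v ≡ᵇ v₀) ∧ (a ≡ᵇ a₀) then sumTo j₀ (λ j → Rrank α v a j (bump o v a) m) else 0)) vars)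

  mutual
    sumTo-Run : ∀ α v a J s (o : Offset) m → sumTo J (λ j → Run α v a j s o m) ≡ Run α v a J (suc s) o m
    sumTo-Run α v a J s o m = trans (sumTo-+ J (λ j → choose j s * R α v a o m) (λ j → Run⁺ α v a j s o m))
      (cong₂ _+_ (trans (sumTo-*ʳ J (R α v a o m) (λ j → choose j s)) (cong (_* R α v a o m) (hockey-stick J s)))
                 (sumTo-Run⁺ α v a J s o m))

    sumTo-Run⁺ : ∀ α v a J s (o : Offset) m → sumTo J (λ j → Run⁺ α v a j s o m) ≡ Run⁺ α v a J (suc s) o m
    sumTo-Run⁺ [] v a J s o m = sumTo-zero J _ (λ _ → refl)
    sumTo-Run⁺ (b ∷ β) v a J s o m = trans (sumTo-if J (b ≡ᵇ a) (λ j → Run β v a j (suc s) (bump o v a) m))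
                                           (if-cong-then (b ≡ᵇ a) (sumTo-Run β v a J (suc s) (bump o v a) m))

  mutual
    Run-zero : ∀ α v a s (o : Offset) m → Run α v a 0 (suc s) o m ≡ 0
    Run-zero α v a s o m = Run⁺-zero α v a s o m

    Run⁺-zero : ∀ α v a s (o : Offset) m → Run⁺ α v a 0 (suc s) o m ≡ 0
    Run⁺-zero [] v a s o m = refl
    Run⁺-zero (b ∷ β) v a s o m = trans (if-cong-then (b ≡ᵇ a) (Run-zero β v a (suc s) (bump o v a) m)) (if-eta (b ≡ᵇ a))

  if-else-split : ∀ (t : Bool) x y → (if t then x else y) ≡ (if t then x else 0) + (if t then 0 else y)
  if-else-split true x y = sym (+-identityʳ x)
  if-else-split false x y = refl

  same-tag-not-after : ∀ v a v₀ a₀ y →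
    (if after v a v₀ a₀ then 0 else (if (v ≡ᵇ v₀) ∧ (a ≡ᵇ a₀) then y else 0)) ≡ (if (v₀ ≡ᵇ v) ∧ (a ≡ᵇ a₀) then y else 0)
  same-tag-not-after v a v₀ a₀ y with (v ≡ᵇ v₀) ∧ (a ≡ᵇ a₀) in e
  ... | true with ∧-true⇒× (v ≡ᵇ v₀) (a ≡ᵇ a₀) e
  ...   | e₁ , e₂ with refl ← ≡ᵇ-true⇒≡ v v₀ e₁ | refl ← ≡ᵇ-true⇒≡ a a₀ e₂ rewrite after-self v a | ≡ᵇ-refl v | ≡ᵇ-refl a = refl
  same-tag-not-after v a v₀ a₀ y | false =
    trans (if-eta (after v a v₀ a₀)) (sym (if-cong (trans (cong (_∧ (a ≡ᵇ a₀)) (≡ᵇ-sym v₀ v)) e)))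

  -- The side condition excludes a sentinel value v₀ outside the variables with j₀ ≠ 0.
  Rrank≡Run : ∀ α v₀ a₀ j₀ (o : Offset) m → (v₀ < n ⊎ j₀ ≡ 0) → Rrank α v₀ a₀ j₀ o m ≡ Run α v₀ a₀ j₀ 0 o m
  Rrank≡Run [] v₀ a₀ j₀ o m c = sym (trans (+-identityʳ _) (*-identityˡ (x^ o m)))
  Rrank≡Run (a ∷ α) v₀ a₀ j₀ o m c = begin
      Rrank (a ∷ α) v₀ a₀ j₀ o m
        ≡⟨ sum-upTo-cong n _ _ (λ v p → cong₂ (λ x y → if after v a v₀ a₀ then x else (if (v ≡ᵇ v₀) ∧ (a ≡ᵇ a₀) then y else 0))
              (trans (sumTo-cong (suc (mult a α)) _ _ (λ j _ → Rrank≡Run α v a j (bump o v a) m (inj₁ p))) (sumTo-Run α v a (suc (mult a α)) 0 (bump o v a) m))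
              (trans (sumTo-cong j₀ _ _ (λ j _ → Rrank≡Run α v a j (bump o v a) m (inj₁ p))) (sumTo-Run α v a j₀ 0 (bump o v a) m))) ⟩
      sum (map (λ v → if after v a v₀ a₀ then fresh v else (if (v ≡ᵇ v₀) ∧ (a ≡ᵇ a₀) then continued v else 0)) vars)
        ≡⟨ trans (sum-map-cong _ _ vars (λ v → if-else-split (after v a v₀ a₀) (fresh v) _)) (sum-map-+ _ _ vars) ⟩
      R (a ∷ α) v₀ a₀ o m + sum (map (λ v → if after v a v₀ a₀ then 0 else (if (v ≡ᵇ v₀) ∧ (a ≡ᵇ a₀) then continued v else 0)) vars)
        ≡⟨ cong₂ _+_ (sym (+-identityʳ _)) (continuation c) ⟩
      Run (a ∷ α) v₀ a₀ j₀ 0 o m ∎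
    where
    open ≡-Reasoning
    fresh continued : ℕ → ℕ
    fresh v = Run α v a (suc (mult a α)) 1 (bump o v a) m
    continued v = Run α v a j₀ 1 (bump o v a) m
    continuation : (v₀ < n ⊎ j₀ ≡ 0) →
      sum (map (λ v → if after v a v₀ a₀ then 0 else (if (v ≡ᵇ v₀) ∧ (a ≡ᵇ a₀) then continued v else 0)) vars)
        ≡ (if a ≡ᵇ a₀ then Run α v₀ a₀ j₀ 1 (bump o v₀ a₀) m else 0)
    continuation (inj₁ p) = trans (sum-map-cong _ _ vars (λ v → same-tag-not-after v a v₀ a₀ (continued v)))
                                  (trans (sum-upTo-≡ᵇ n v₀ (a ≡ᵇ a₀) continued p) (same-weight (a ≡ᵇ a₀) (≡ᵇ-true⇒≡ a a₀)))
      where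
      same-weight : ∀ (b : Bool) → (b ≡ true → a ≡ a₀) → (if b then continued v₀ else 0) ≡ (if b then Run α v₀ a₀ j₀ 1 (bump o v₀ a₀) m else 0)
      same-weight true h with refl ← h refl = refl
      same-weight false h = refl
    continuation (inj₂ refl) =
      trans (sum-map-zero _ vars (λ v → trans (cong (λ z → if after v a v₀ a₀ then 0 else (if (v ≡ᵇ v₀) ∧ (a ≡ᵇ a₀) then z else 0)) (Run-zero α v a 0 (bump o v a) m))
                                   (trans (cong (λ z → if after v a v₀ a₀ then 0 else z) (if-eta ((v ≡ᵇ v₀) ∧ (a ≡ᵇ a₀)))) (if-eta (after v a v₀ a₀)))))
            (sym (trans (if-cong-then (a ≡ᵇ a₀) (Run-zero α v₀ a₀ 0 (bump o v₀ a₀) m)) (if-eta (a ≡ᵇ a₀))))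

withoutLabel : (ℕ → ℕ → Bool) → ℕ → ℕ → ℕ → ℕ → Bool
withoutLabel π a k a' k' = π a' k' ∧ not ((a ≡ᵇ a') ∧ (k ≡ᵇ k'))

chainOK-reorder : ∀ p pt de dt cb cbt ce ct eq → (cb ≡ true → ce ≡ true → cbt ≡ true) →
  ((p ∧ pt) ∧ ((de ∧ dt) ∧ ((cb ∧ cbt) ∧ ((ce ∧ ct) ∧ eq)))) ≡ ((p ∧ cb) ∧ ((pt ∧ de) ∧ (dt ∧ (ce ∧ (ct ∧ eq)))))
chainOK-reorder p pt de dt false cbt ce ct eq h
  rewrite ∧-zeroʳ (de ∧ dt) | ∧-zeroʳ (p ∧ pt) | ∧-zeroʳ p = refl
chainOK-reorder p pt de dt true cbt false ct eq h
  rewrite ∧-zeroʳ cbt | ∧-zeroʳ (de ∧ dt) | ∧-zeroʳ (p ∧ pt) | ∧-zeroʳ dt | ∧-zeroʳ (pt ∧ de) | ∧-zeroʳ (p ∧ true) = refl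
chainOK-reorder p pt de dt true cbt true ct eq h rewrite h refl refl with p | pt
... | false | _ = refl
... | true | false = refl
... | true | true = ∧-assoc de dt (ct ∧ eq)

-- chains α π b o m counts the chains with weights α that may follow the entry b, whose labels
-- are admissible for π and pairwise distinct, and that take the exponent o to m.
module ChainCount (n : ℕ) (labels : List ℕ) (labels-increasing : AllPairs _<_ labels) where
  open RunCount n using (vars)
  open RankedRuns n

  chainOK : (ℕ → ℕ → Bool) → Entry → Offset → Vec ℕ n → List Entry → Bool
  chainOK π b o m t = allB (λ e → π (proj₁ (proj₁ e)) (proj₂ (proj₁ e))) t ∧ (allPairsB distinctElts t ∧ (allB (compatible b) t
                        ∧ (allPairsB compatible t ∧ eqListB (map (λ x → o x + expo t x) vars) (toList m))))

  chains : List ℕ → (ℕ → ℕ → Bool) → Entry → Offset → Vec ℕ n → ℕ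
  chains α π b o m = sum (map (λ ks → sum (map (λ vs → 𝟙 (chainOK π b o m (zip (zip α ks) vs))) (words (length α) vars))) (words (length α) labels))

  chainOK-∷ : ∀ π b (o : Offset) m a k v (t : List Entry) →
    chainOK π b o m (((a , k) , v) ∷ t) ≡ ((π a k ∧ compatible b ((a , k) , v)) ∧ chainOK (withoutLabel π a k) ((a , k) , v) (bump o v a) m t)
  chainOK-∷ π b o m a k v t =
    trans (cong (λ z → (π a k ∧ allB P t) ∧ ((allB (distinctElts e) t ∧ allPairsB distinctElts t) ∧ ((compatible b e ∧ allB (compatible b) t)
                         ∧ ((allB (compatible e) t ∧ allPairsB compatible t) ∧ eqListB z (toList m)))))
                (map-cong (λ x → sym (+-assoc (o x) (if v ≡ᵇ x then a else 0) (expo t x))) vars))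
    (trans (chainOK-reorder (π a k) (allB P t) (allB (distinctElts e) t) (allPairsB distinctElts t) (compatible b e) (allB (compatible b) t)
                      (allB (compatible e) t) (allPairsB compatible t) _ (λ p q → allB-compatible-trans b e t p q))
           (cong (λ z → (π a k ∧ compatible b e) ∧ (z ∧ _)) (sym (allB-∧ P (distinctElts e) t))))
    where
    e = ((a , k) , v)
    P : Entry → Bool
    P e = π (proj₁ (proj₁ e)) (proj₂ (proj₁ e))

  chains-∷ : ∀ a α' π b (o : Offset) m →
    chains (a ∷ α') π b o m ≡ sum (map (λ k → sum (map (λ v → 𝟙 (π a k ∧ compatible b ((a , k) , v)) * chains α' (withoutLabel π a k) ((a , k) , v) (bump o v a) m) vars)) labels)
  chains-∷ a α' π b o m = begin
      chains (a ∷ α') π b o m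
        ≡⟨ sum-words-suc _ ℓ labels ⟩
      sum (map (λ k → sum (map (λ ks → sum (map (λ vs → 𝟙 (chainOK π b o m (zip (zip (a ∷ α') (k ∷ ks)) vs))) (words (suc ℓ) vars))) (words ℓ labels))) labels)
        ≡⟨ sum-map-cong _ _ labels (λ k → sum-map-cong _ _ (words ℓ labels) (λ ks → trans (sum-words-suc _ ℓ vars)
              (sum-map-cong _ _ vars (λ v → trans (sum-map-cong _ _ (words ℓ vars) (λ vs → trans (cong 𝟙 (chainOK-∷ π b o m a k v (zip (zip α' ks) vs))) (𝟙-∧ (π a k ∧ compatible b ((a , k) , v)) _)))
                                              (sum-map-* (𝟙 (π a k ∧ compatible b ((a , k) , v))) (λ vs → 𝟙 (chainOK (withoutLabel π a k) ((a , k) , v) (bump o v a) m (zip (zip α' ks) vs))) (words ℓ vars)))))) ⟩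
      sum (map (λ k → sum (map (λ ks → sum (map (λ v → 𝟙 (π a k ∧ compatible b ((a , k) , v)) * inner k v ks) vars)) (words ℓ labels))) labels)
        ≡⟨ sum-map-cong _ _ labels (λ k → trans (sum-swap (λ ks v → 𝟙 (π a k ∧ compatible b ((a , k) , v)) * inner k v ks) (words ℓ labels) vars)
              (sum-map-cong _ _ vars (λ v → sum-map-* (𝟙 (π a k ∧ compatible b ((a , k) , v))) (inner k v) (words ℓ labels)))) ⟩
      sum (map (λ k → sum (map (λ v → 𝟙 (π a k ∧ compatible b ((a , k) , v)) * chains α' (withoutLabel π a k) ((a , k) , v) (bump o v a) m) vars)) labels) ∎
    where
    open ≡-Reasoning
    ℓ = length α'
    inner : ℕ → ℕ → List ℕ → ℕ
    inner k v ks = sum (map (λ vs → 𝟙 (chainOK (withoutLabel π a k) ((a , k) , v) (bump o v a) m (zip (zip α' ks) vs))) (words ℓ vars))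

  rank : (ℕ → ℕ → Bool) → ℕ → ℕ → ℕ
  rank π a₀ k₀ = countB (λ k → π a₀ k ∧ (k <ᵇ k₀)) labels

  rank-withoutLabel : ∀ π a k → rank (withoutLabel π a k) a k ≡ rank π a k
  rank-withoutLabel π a k = countB-cong _ _ labels below-k
    where
    below-k : ∀ k' → ((π a k' ∧ not ((a ≡ᵇ a) ∧ (k ≡ᵇ k'))) ∧ (k' <ᵇ k)) ≡ (π a k' ∧ (k' <ᵇ k))
    below-k k' with k' <ᵇ k in e
    ... | false = trans (∧-zeroʳ _) (sym (∧-zeroʳ (π a k')))
    ... | true rewrite ≡ᵇ-refl a | ≢⇒≡ᵇ-false (≢-sym (<⇒≢ (<ᵇ-true⇒< k' k e))) = cong (_∧ true) (∧-identityʳ (π a k'))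

  countB-withoutLabel : ∀ π a k α' → (∀ x → countB (π x) labels ≡ mult x (a ∷ α')) → π a k ≡ true → countB (k ≡ᵇ_) labels ≡ 1 →
    ∀ x → countB (withoutLabel π a k x) labels ≡ mult x α'
  countB-withoutLabel π a k α' h πak once x with a ≡ᵇ x in e
  ... | false = trans (countB-cong _ _ labels (λ k' → ∧-identityʳ (π x k')))
                      (trans (h x) (cong (λ z → 𝟙 z + mult x α') (trans (≡ᵇ-sym x a) e)))
  ... | true with refl ← ≡ᵇ-true⇒≡ a x e = +-cancelʳ-≡ 1 _ _ (begin
      countB (λ k' → π a k' ∧ not (k ≡ᵇ k')) labels + 1
        ≡⟨ cong (countB (λ k' → π a k' ∧ not (k ≡ᵇ k')) labels +_) (sym (cong₂ _*_ (cong 𝟙 πak) once)) ⟩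
      countB (λ k' → π a k' ∧ not (k ≡ᵇ k')) labels + 𝟙 (π a k) * countB (k ≡ᵇ_) labels
        ≡⟨ countB-remove (π a) k labels ⟩
      countB (π a) labels
        ≡⟨ trans (h a) (trans (mult-∷-self a α') (+-comm 1 (mult a α'))) ⟩
      mult a α' + 1 ∎)
    where open ≡-Reasoning

  sum-admissible-labels : ∀ π a α' a₀ k₀ v₀ v → (∀ x → countB (π x) labels ≡ mult x (a ∷ α')) → (g : ℕ → ℕ) →
    sum (map (λ k → 𝟙 (π a k ∧ compatible ((a₀ , k₀) , v₀) ((a , k) , v)) * g (rank π a k)) labels)
      ≡ (if after v a v₀ a₀ then sumTo (suc (mult a α')) g
         else (if (v ≡ᵇ v₀) ∧ (a ≡ᵇ a₀) then sumTo (rank π a₀ k₀) g else 0))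
  sum-admissible-labels π a α' a₀ k₀ v₀ v h g with after v a v₀ a₀ in et
  ... | true = trans (sum-map-cong _ _ labels (λ k → cong (λ z → 𝟙 z * g (rank π a k))
                       (trans (cong (π a k ∧_) (compatible-after a₀ k₀ v₀ a k v et)) (∧-identityʳ (π a k)))))
                (trans (sum-by-rank labels labels-increasing (π a) g) (cong (λ z → sumTo z g) (trans (h a) (mult-∷-self a α'))))
  ... | false with (v ≡ᵇ v₀) ∧ (a ≡ᵇ a₀) in eq
  ...   | false = sum-map-zero _ labels (λ k → cong (λ z → 𝟙 z * g (rank π a k))
                    (∧-falseʳ (π a k) (incompatible-otherwise a₀ k₀ v₀ a k v et eq)))
  ...   | true with ∧-true⇒× (v ≡ᵇ v₀) (a ≡ᵇ a₀) eq
  ...     | e₁ , e₂ with refl ← ≡ᵇ-true⇒≡ v v₀ e₁ | refl ← ≡ᵇ-true⇒≡ a a₀ e₂ =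
    trans (sum-map-cong _ _ labels (λ k → cong (λ z → 𝟙 (π a k ∧ z) * g (rank π a k)) (compatible-same-tag a k₀ k v)))
          (sum-by-rank-below labels labels-increasing (π a) g k₀)

  chains≡Rrank : ∀ α π a₀ k₀ v₀ (o : Offset) m → (∀ x → countB (π x) labels ≡ mult x α) →
    chains α π ((a₀ , k₀) , v₀) o m ≡ Rrank α v₀ a₀ (rank π a₀ k₀) o m
  chains≡Rrank [] π a₀ k₀ v₀ o m h =
    trans (+-identityʳ _) (trans (+-identityʳ _) (cong (λ l → 𝟙 (eqListB l (toList m))) (map-cong (λ x → +-identityʳ (o x)) vars)))
  chains≡Rrank (a ∷ α') π a₀ k₀ v₀ o m h = begin
      chains (a ∷ α') π b o m
        ≡⟨ chains-∷ a α' π b o m ⟩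
      sum (map (λ k → sum (map (λ v → 𝟙 (π a k ∧ compatible b ((a , k) , v)) * chains α' (withoutLabel π a k) ((a , k) , v) (bump o v a) m) vars)) labels)
        ≡⟨ sum-map-congAll _ _ labels (All.map (λ {k} once → sum-map-cong _ _ vars (λ v → tail k v once)) (countB-≡ᵇ-once labels labels-increasing)) ⟩
      sum (map (λ k → sum (map (λ v → 𝟙 (π a k ∧ compatible b ((a , k) , v)) * g v (rank π a k)) vars)) labels)
        ≡⟨ sum-swap (λ k v → 𝟙 (π a k ∧ compatible b ((a , k) , v)) * g v (rank π a k)) labels vars ⟩
      sum (map (λ v → sum (map (λ k → 𝟙 (π a k ∧ compatible b ((a , k) , v)) * g v (rank π a k)) labels)) vars)
        ≡⟨ sum-map-cong _ _ vars (λ v → sum-admissible-labels π a α' a₀ k₀ v₀ v h (g v)) ⟩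
      Rrank (a ∷ α') v₀ a₀ (rank π a₀ k₀) o m ∎
    where
    open ≡-Reasoning
    b = ((a₀ , k₀) , v₀)
    g : ℕ → ℕ → ℕ
    g v j = Rrank α' v a j (bump o v a) m
    tail : ∀ k v → countB (k ≡ᵇ_) labels ≡ 1 →
      𝟙 (π a k ∧ compatible b ((a , k) , v)) * chains α' (withoutLabel π a k) ((a , k) , v) (bump o v a) m
        ≡ 𝟙 (π a k ∧ compatible b ((a , k) , v)) * g v (rank π a k)
    tail k v once with π a k in πak
    ... | false = refl
    ... | true = cong (𝟙 (compatible b ((a , k) , v)) *_)
                  (trans (chains≡Rrank α' (withoutLabel π a k) a k v (bump o v a) m (countB-withoutLabel π a k α' h πak once))
                         (cong (g v) (rank-withoutLabel π a k)))

-- The power sum and z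

sumTo-<ᵇ : ∀ ℓ r → r ≤ ℓ → sumTo ℓ (λ i → 𝟙 (i <ᵇ r)) ≡ r
sumTo-<ᵇ ℓ zero p = sumTo-zero ℓ _ (λ _ → refl)
sumTo-<ᵇ (suc ℓ) (suc r) (s≤s p) = cong suc (sumTo-<ᵇ ℓ r p)

inPosetLabel : List ℕ → ℕ → ℕ → Bool
inPosetLabel α a k = (1 ≤ᵇ k) ∧ (k ≤ᵇ mult a α)

countB-inPosetLabel : ∀ α x → countB (inPosetLabel α x) (map suc (upTo (length α))) ≡ mult x α
countB-inPosetLabel α x = begin
    countB (inPosetLabel α x) (map suc (upTo (length α)))
      ≡⟨ countB-sum (inPosetLabel α x) (map suc (upTo (length α))) ⟩
    sum (map (λ k → 𝟙 (inPosetLabel α x k)) (map suc (upTo (length α))))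
      ≡⟨ sum-map-map (λ k → 𝟙 (inPosetLabel α x k)) suc (upTo (length α)) ⟩
    sum (map (λ i → 𝟙 (inPosetLabel α x (suc i))) (upTo (length α)))
      ≡⟨ sum-upTo (length α) (λ i → 𝟙 (inPosetLabel α x (suc i))) ⟩
    sumTo (length α) (λ i → 𝟙 (i <ᵇ mult x α))
      ≡⟨ sumTo-<ᵇ (length α) (mult x α) (mult≤length x α) ⟩
    mult x α ∎
  where open ≡-Reasoning

labels-increasing : ∀ ℓ → AllPairs _<_ (map suc (upTo ℓ))
labels-increasing ℓ = AllPairsP.map⁺ (AllPairsP.applyUpTo⁺₁ id ℓ (λ i<j _ → s<s i<j))

sentinel-compatible : ∀ B a k v → a < B → compatible ((B , 0) , 0) ((a , k) , v) ≡ true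
sentinel-compatible B a k zero p = compatible-complete ((B , 0) , 0) ((a , k) , 0) (inj₂ (refl , inj₁ p))
sentinel-compatible B a k (suc v) p = compatible-complete ((B , 0) , 0) ((a , k) , suc v) (inj₁ z<s)

allB-sentinel-compatible : ∀ α B (t : List Entry) → All (_< B) α → allB (inPoset α) t ≡ true → allB (compatible ((B , 0) , 0)) t ≡ true
allB-sentinel-compatible α B [] h e = refl
allB-sentinel-compatible α B (((a , k) , v) ∷ t) h e with ∧-true⇒× (inPoset α ((a , k) , v)) _ e
... | e₁ , e₂ with ∧-true⇒× (1 ≤ᵇ k) (k ≤ᵇ mult a α) e₁
...   | p , q rewrite sentinel-compatible B a k v (mult-pos⇒< a α B h (≤-trans (≤ᵇ-true⇒≤ 1 k p) (≤ᵇ-true⇒≤ k (mult a α) q)))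
  = allB-sentinel-compatible α B t h e₂

-- A sentinel entry ((B , 0) , 0) heavier than every part can precede any chain.
𝓅≡R : ∀ n α B m → All (_< B) α → 𝓅 α n m ≡ RunCount.R n α 0 B (λ _ → 0) m
𝓅≡R n α B m h = begin
    𝓅 α n m
      ≡⟨ trans (countB-sum P (concatMap (λ ks → map (ks ,_) Vs) Ks))
           (trans (sum-concatMap (λ c → 𝟙 (P c)) (λ ks → map (ks ,_) Vs) Ks) (sum-map-cong _ _ Ks (λ ks → sum-map-map (λ c → 𝟙 (P c)) (ks ,_) Vs))) ⟩
    sum (map (λ ks → sum (map (λ vs → 𝟙 (ok (zip (zip α ks) vs))) Vs)) Ks)
      ≡⟨ sum-map-cong _ _ Ks (λ ks → sum-map-cong _ _ Vs (λ vs → cong 𝟙 (with-sentinel (zip (zip α ks) vs)))) ⟩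
    ChainCount.chains n labels (labels-increasing ℓ) α (inPosetLabel α) ((B , 0) , 0) (λ _ → 0) m
      ≡⟨ ChainCount.chains≡Rrank n labels (labels-increasing ℓ) α (inPosetLabel α) B 0 0 (λ _ → 0) m (countB-inPosetLabel α) ⟩
    Rrank α 0 B (countB (λ k → inPosetLabel α B k ∧ (k <ᵇ 0)) labels) (λ _ → 0) m
      ≡⟨ cong (λ j → Rrank α 0 B j (λ _ → 0) m) (countB-false _ labels (All.universal (λ _ → ∧-zeroʳ _) labels)) ⟩
    Rrank α 0 B 0 (λ _ → 0) m
      ≡⟨ Rrank≡Run α 0 B 0 (λ _ → 0) m (inj₂ refl) ⟩
    Run α 0 B 0 0 (λ _ → 0) m
      ≡⟨ trans (cong (choose 0 0 * R α 0 B (λ _ → 0) m +_) (sentinel-run α)) (trans (+-identityʳ _) (*-identityˡ _)) ⟩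
    R α 0 B (λ _ → 0) m ∎
  where
  open ≡-Reasoning
  open RunCount n
  open RankedRuns n
  ℓ = length α
  labels = map suc (upTo ℓ)
  Ks = words ℓ labels
  Vs = words ℓ (upTo n)
  ok : List Entry → Bool
  ok t = (allB (inPoset α) t ∧ allPairsB distinctElts t) ∧ (allPairsB compatible t ∧ eqListB (map (expo t) (upTo n)) (toList m))
  P : List ℕ × List ℕ → Bool
  P c = ok (zip (zip α (proj₁ c)) (proj₂ c))
  with-sentinel : ∀ t → ok t ≡ (allB (inPoset α) t ∧ (allPairsB distinctElts t ∧ (allB (compatible ((B , 0) , 0)) t
                                  ∧ (allPairsB compatible t ∧ eqListB (map (expo t) (upTo n)) (toList m)))))
  with-sentinel t with allB (inPoset α) t in e
  ... | false = refl
  ... | true rewrite allB-sentinel-compatible α B t h e = refl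
  sentinel-run : ∀ β → Run⁺ β 0 B 0 0 (λ _ → 0) m ≡ 0
  sentinel-run [] = refl
  sentinel-run (b ∷ β) = trans (if-cong-then (b ≡ᵇ B) (Run-zero β 0 B 0 (bump (λ _ → 0) 0 B) m)) (if-eta (b ≡ᵇ B))

productTo : ℕ → (ℕ → ℕ) → ℕ
productTo zero g = 1
productTo (suc N) g = g 0 * productTo N (λ j → g (suc j))

product-upTo : ∀ N (f : ℕ → ℕ) → product (map f (upTo N)) ≡ productTo N f
product-upTo N f = go N id
  where
  go : ∀ N g → product (map f (applyUpTo g N)) ≡ productTo N (λ j → f (g j))
  go zero g = refl
  go (suc N) g = cong (f (g 0) *_) (go N (λ j → g (suc j)))

productTo-cong : ∀ N (f g : ℕ → ℕ) → (∀ j → f j ≡ g j) → productTo N f ≡ productTo N g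
productTo-cong zero f g h = refl
productTo-cong (suc N) f g h = cong₂ _*_ (h 0) (productTo-cong N _ _ (λ j → h (suc j)))

productTo-* : ∀ N (f g : ℕ → ℕ) → productTo N (λ j → f j * g j) ≡ productTo N f * productTo N g
productTo-* zero f g = refl
productTo-* (suc N) f g =
  trans (cong (f 0 * g 0 *_) (productTo-* N (λ j → f (suc j)) (λ j → g (suc j)))) (*-interchange (f 0) (g 0) _ _)

productTo-one : ∀ N → productTo N (λ _ → 1) ≡ 1
productTo-one zero = refl
productTo-one (suc N) = trans (+-identityʳ _) (productTo-one N)

productTo-single : ∀ N x c → x < N → productTo N (λ a → if x ≡ᵇ a then c else 1) ≡ c
productTo-single (suc N) zero c p = trans (cong (c *_) (productTo-one N)) (*-identityʳ c)
productTo-single (suc N) (suc x) c (s≤s p) = trans (+-identityʳ _) (productTo-single N x c p)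

-- With the bound N above all parts, this is z α written part by part.
product-powers-factorials : ∀ N α → All (_< N) α →
  product (map (λ a → a ^ mult a α * (mult a α) !) (upTo N)) ≡ product α * mults! α
product-powers-factorials N [] h = trans (product-upTo N _) (productTo-one N)
product-powers-factorials N (x ∷ xs) (p ∷ h) = begin
    product (map (λ a → a ^ mult a (x ∷ xs) * (mult a (x ∷ xs)) !) (upTo N))
      ≡⟨ product-upTo N _ ⟩
    productTo N (λ a → a ^ mult a (x ∷ xs) * (mult a (x ∷ xs)) !)
      ≡⟨ productTo-cong N _ _ factor-x ⟩
    productTo N (λ a → (if x ≡ᵇ a then x * suc r else 1) * f a)
      ≡⟨ productTo-* N _ _ ⟩
    productTo N (λ a → if x ≡ᵇ a then x * suc r else 1) * productTo N f
      ≡⟨ cong₂ _*_ (productTo-single N x (x * suc r) p) (trans (sym (product-upTo N f)) (product-powers-factorials N xs h)) ⟩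
    x * suc r * (product xs * mults! xs)
      ≡⟨ *-interchange x (suc r) (product xs) (mults! xs) ⟩
    x * product xs * (suc r * mults! xs) ∎
  where
  open ≡-Reasoning
  r = mult x xs
  f : ℕ → ℕ
  f a = a ^ mult a xs * (mult a xs) !
  factor-x : ∀ a → a ^ mult a (x ∷ xs) * (mult a (x ∷ xs)) ! ≡ (if x ≡ᵇ a then x * suc r else 1) * f a
  factor-x a with a ≡ᵇ x in e
  ... | true with refl ← ≡ᵇ-true⇒≡ a x e rewrite ≡ᵇ-refl a = regroup a (a ^ mult a xs) (mult a xs) (mult a xs !)
    where
    regroup : ∀ a p r r! → a * p * (r! + r * r!) ≡ a * suc r * (p * r!)
    regroup = solve-∀
  ... | false rewrite ≡ᵇ-sym x a | e = sym (+-identityʳ _)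

All-<-suc-sum : ∀ α → All (_< suc (sum α)) α
All-<-suc-sum [] = []
All-<-suc-sum (x ∷ xs) = s≤s (m≤m+n x (sum xs)) ∷ All.map (λ q → ≤-trans q (s≤s (m≤n+m (sum xs) x))) (All-<-suc-sum xs)

z≡product*mults! : ∀ α → z α ≡ product α * mults! α
z≡product*mults! α = product-powers-factorials (suc (sum α)) α (All-<-suc-sum α)

theorem5p5 : (α β : List ℕ) → IsComposition α → IsComposition β →
    (n : ℕ) (m : Vec ℕ n) →
    z (α ++ β) * (𝓅 α n ⊛ 𝓅 β n) m ≡ z α * z β * sum (map (λ γ → 𝓅 γ n m) (shuffle α β))
theorem5p5 α β _ _ n m = begin
    z (α ++ β) * (𝓅 α n ⊛ 𝓅 β n) m
      ≡⟨ cong₂ _*_ (trans (z≡product*mults! (α ++ β)) (cong (_* mults! (α ++ β)) (product-++ α β)))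
                   (trans (⊛-congˡ (𝓅 α n) (R α 0 B o₀) (𝓅 β n) m (λ x → 𝓅≡R n α B x (AllP.++⁻ˡ α bounded)))
                          (⊛-congʳ (R α 0 B o₀) (𝓅 β n) (R β 0 B o₀) m (λ x → 𝓅≡R n β B x (AllP.++⁻ʳ α bounded)))) ⟩
    product α * product β * mults! (α ++ β) * (R α 0 B o₀ ⊛ R β 0 B o₀) m
      ≡⟨ trans (*-assoc (product α * product β) _ _)
               (cong (product α * product β *_) (product-formula (length α + length β) α β ≤-refl 0 B o₀ o₀ m)) ⟩
    product α * product β * (mults! α * mults! β * R⧢ α β 0 B (o₀ ⊕ o₀) m)
      ≡⟨ regroup (product α) (product β) (mults! α) (mults! β) _ ⟩
    product α * mults! α * (product β * mults! β) * R⧢ α β 0 B (o₀ ⊕ o₀) m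
      ≡⟨ cong₂ (λ u w → u * w * R⧢ α β 0 B (o₀ ⊕ o₀) m) (sym (z≡product*mults! α)) (sym (z≡product*mults! β)) ⟩
    z α * z β * R⧢ α β 0 B (o₀ ⊕ o₀) m
      ≡⟨ cong (z α * z β *_) (sym (sum-map-congAll _ _ (shuffle α β)
           (All.map (λ γ↭ → 𝓅≡R n _ B m (Perm.All-resp-↭ (↭-sym γ↭) bounded)) (shuffle-↭ α β)))) ⟩
    z α * z β * sum (map (λ γ → 𝓅 γ n m) (shuffle α β)) ∎
  where
  open ≡-Reasoning
  open RunCount n
  open ProductFormula n
  B = suc (sum (α ++ β))
  bounded = All-<-suc-sum (α ++ β)
  o₀ : Offset
  o₀ _ = 0
  regroup : ∀ pa pb la lb s → pa * pb * (la * lb * s) ≡ pa * la * (pb * lb) * s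
  regroup = solve-∀
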